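{- Let $\mathcal{G}$ be a marked simple graph with countable vertex set $I$ and let $\mathbf{m}\in\mathbb{Z}_+^I$ have finite support. Then $${_{\mathbf{m}}\Pi^{\mathrm{mark}}_\mathcal{G}}(q)=\sum_{\boldsymbol{\lambda}\in S(\mathbf m)} \frac{\pi_{\mathcal{G}(\mathbf s(\boldsymbol{\lambda}))}(q)}{\prod_{i\in \mathrm{supp}(\mathbf m)}\prod_{k=1}^{\infty}(d^{\boldsymbol{\lambda}_i}_{k}!)}.$$
   Context: $\mathcal{G}$ has edge set $E$ and marking $I_1^{\mathrm{it}}\subseteq I_1\subseteq I$ (vertices of $I_1^{\mathrm{it}}$ odd isotropic). ${_{\mathbf{m}}\Pi^{\mathrm{mark}}_\mathcal{G}}(q)$ (for $q\in\mathbb{N}$) is the number of maps $\Gamma$ from $I$ to finite multisubsets of $\{1,\dots,q\}$ with $\Gamma(i)$ a set for $i\notin I_1^{\mathrm{it}}$, $|\Gamma(i)|=m_i$ (with multiplicity), and $\Gamma(i)\cap\Gamma(j)=\emptyset$ for adjacent $i,j$. For a finite simple graph $H$, $\pi_H(q)$ is its ordinary chromatic polynomial (number of proper vertex colorings with colors $\{1,\dots,q\}$). For $\mathbf{n}\in\mathbb{Z}_+^I$ with finite support, the join $\mathcal{G}(\mathbf{n})$ is the graph with vertices $\{i_1,\dots,i_{n_i}: i\in\mathrm{supp}(\mathbf{n})\}$ and edges $\{i_r,i_s\}$ for $1\le r\neq s\le n_i$, and $\{i_r,j_s\}$ for all $r,s$ whenever $(i,j)\in E$. For a partition $\lambda$,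 $\ell(\lambda)$ is its number of parts and $d_k^{\lambda}$ the number of parts equal to $k$. $S(\mathbf{m})$ is the set of tuples $\boldsymbol{\lambda}=(\boldsymbol{\lambda}_i)_{i\in I}$ with $\boldsymbol{\lambda}_i$ a partition of $m_i$ (the empty partition if $m_i=0$) and $\boldsymbol{\lambda}_i=(1^{m_i})$ for all $i\notin I_1^{\mathrm{it}}$; $\mathbf{s}(\boldsymbol{\lambda})=(\ell(\boldsymbol{\lambda}_i))_{i\in I}$, with the empty partition of length $0$. -}

module Defs where

open import Level using (0ℓ)
open import Data.Bool using (Bool; true; false; T)
open import Data.Nat using (ℕ; zero; suc; _+_; _*_; _≤_; _≥_)
open import Data.Nat using (_!)
open import Data.Nat.ListAction using (sum; product)
open import Data.Fin using (Fin)
open import Data.List using (List; []; _∷_; length; filter; replicate; map; upTo; foldr)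
import Data.List
open import Data.List.Relation.Unary.All using (All)
open import Data.List.Relation.Unary.Linked using (Linked)
open import Data.Product using (Σ; _×_; _,_; proj₁; proj₂)
open import Data.Sum using (_⊎_)
open import Relation.Nullary using (¬_)
open import Relation.Binary.Bundles using (Setoid)
open import Relation.Binary.PropositionalEquality as ≡ using (_≡_; _≢_)
open import Function.Bundles using (Bijection)
open import Data.Rational as ℚ using (ℚ)
import Data.Integer as ℤ
import Data.Nat as ℕ

-- Marked simple graphs on a vertex set I.
-- adj is the edge relation (Bool-valued, symmetric, irreflexive);
-- I₁ is the marking and isoIt the subset I₁^it ⊆ I₁ of odd isotropic vertices.

record MarkedGraph (I : Set) : Set where
  field
    adj       : I → I → Bool
    adj-sym   : ∀ i j → adj i j ≡ adj j i
    adj-irr   : ∀ i → adj i i ≡ false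
    I₁        : I → Bool
    isoIt     : I → Bool
    isoIt⊆I₁  : ∀ i → T (isoIt i) → T (I₁ i)

open MarkedGraph public

HasCard : Setoid 0ℓ 0ℓ → ℕ → Set
HasCard S n = Bijection (≡.setoid (Fin n)) S

sumFin : ∀ {q} → (Fin q → ℕ) → ℕ
sumFin {zero}  f = 0
sumFin {suc q} f = f Fin.zero + sumFin (λ c → f (Fin.suc c))
  where import Data.Fin as Fin

-- Marked maps Γ : I → multisubsets of {1..q}.
-- A multiset of {1,…,q} is its multiplicity function Fin q → ℕ;
-- its size (with multiplicity) is the sum of multiplicities.

Multiset : ℕ → Set
Multiset q = Fin q → ℕ

IsMarkedMap : {I : Set} → MarkedGraph I → (I → ℕ) → (q : ℕ) → (I → Multiset q) → Set
IsMarkedMap G m q Γ =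
    (∀ i → isoIt G i ≡ false → ∀ c → Γ i c ≤ 1)
  × (∀ i → sumFin (Γ i) ≡ m i)
  × (∀ i j → adj G i j ≡ true → ∀ c → Γ i c ≡ 0 ⊎ Γ j c ≡ 0)

MarkedMaps : {I : Set} → MarkedGraph I → (I → ℕ) → ℕ → Setoid 0ℓ 0ℓ
MarkedMaps {I} G m q = record
  { Carrier = Σ (I → Multiset q) (IsMarkedMap G m q)
  ; _≈_ = λ Γ Δ → ∀ i c → proj₁ Γ i c ≡ proj₁ Δ i c
  ; isEquivalence = record
    { refl = λ i c → ≡.refl
    ; sym = λ p i c → ≡.sym (p i c)
    ; trans = λ p r i c → ≡.trans (p i c) (r i c) } }

-- The join graph 𝒢(n): vertices i_r (i ∈ I, r < n_i), edges between
-- distinct copies of the same vertex, and between all copies of adjacent vertices.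

JoinVertex : {I : Set} → (I → ℕ) → Set
JoinVertex {I} n = Σ I (λ i → Fin (n i))

JoinAdj : {I : Set} → MarkedGraph I → (n : I → ℕ) → JoinVertex n → JoinVertex n → Set
JoinAdj G n u v = (proj₁ u ≡ proj₁ v × u ≢ v) ⊎ adj G (proj₁ u) (proj₁ v) ≡ true

-- Proper q-colourings of 𝒢(n); π_{𝒢(n)}(q) is the cardinality of this setoid.
ProperColourings : {I : Set} → MarkedGraph I → (I → ℕ) → ℕ → Setoid 0ℓ 0ℓ
ProperColourings G n q = record
  { Carrier = Σ (JoinVertex n → Fin q) (λ f → ∀ u v → JoinAdj G n u v → f u ≢ f v)
  ; _≈_ = λ f g → ∀ u → proj₁ f u ≡ proj₁ g u
  ; isEquivalence = record
    { refl = λ u → ≡.refl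
    ; sym = λ p u → ≡.sym (p u)
    ; trans = λ p r u → ≡.trans (p u) (r u) } }

IsPartition : ℕ → List ℕ → Set
IsPartition n λs = Linked _≥_ λs × All (λ k → 1 ≤ k) λs × sum λs ≡ n

mult : ℕ → List ℕ → ℕ
mult k λs = length (filter (λ x → x ℕ.≟ k) λs)

-- ∏_{k ≥ 1} (d_k^λ)!  ; factors with k > |λ| = sum λ are 0! = 1, so the
-- product is truncated at k = sum λ.
multFact : List ℕ → ℕ
multFact λs = product (map (λ k → (mult (suc k) λs) !) (upTo (sum λs)))

IsInS : {I : Set} → MarkedGraph I → (I → ℕ) → (I → List ℕ) → Set
IsInS G m Λ = (∀ i → IsPartition (m i) (Λ i))
            × (∀ i → isoIt G i ≡ false → Λ i ≡ replicate (m i) 1)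

SSetoid : {I : Set} → MarkedGraph I → (I → ℕ) → Setoid 0ℓ 0ℓ
SSetoid {I} G m = record
  { Carrier = Σ (I → List ℕ) (IsInS G m)
  ; _≈_ = λ Λ Μ → ∀ i → proj₁ Λ i ≡ proj₁ Μ i
  ; isEquivalence = record
    { refl = λ i → ≡.refl
    ; sym = λ p i → ≡.sym (p i)
    ; trans = λ p r i → ≡.trans (p i) (r i) } }

sVec : {I : Set} → (I → List ℕ) → I → ℕ
sVec Λ i = length (Λ i)

denom : {I : Set} → List I → (I → List ℕ) → ℕ
denom sp Λ = product (map (λ i → multFact (Λ i)) sp)

fromℕ : ℕ → ℚ
fromℕ n = ℤ.+ n ℚ./ 1

-- p / d as a rational (d = 0 never occurs in use: denominators are products of factorials)
frac : ℕ → ℕ → ℚ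
frac p zero    = ℚ.0ℚ
frac p (suc d) = ℤ.+ p ℚ./ suc d

sumℚ : List ℚ → ℚ
sumℚ = foldr ℚ._+_ ℚ.0ℚ

SCarrier : {I : Set} → MarkedGraph I → (I → ℕ) → Set
SCarrier G m = Setoid.Carrier (SSetoid G m)

module Submission where

open import Defs
open import Data.Nat using (ℕ)
open import Data.List using (List; map)
open import Data.List.Membership.Propositional using (_∈_)
open import Data.List.Relation.Unary.Unique.Propositional using (Unique)
open import Data.Product using (proj₁)
open import Relation.Binary.PropositionalEquality using (_≡_; _≢_)
open import Function.Definitions using (Injective)
import Data.List.Relation.Unary.Enumerates.Setoid as Enum
import Data.List.Relation.Unary.Unique.Setoid as USet

open import Level using (0ℓ)
open import Data.Bool using (true; false)
open import Data.Empty using (⊥; ⊥-elim)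
open import Data.Unit using (⊤; tt)
open import Data.Sum using (_⊎_; inj₁; inj₂)
open import Data.Product using (Σ; ∃; _×_; _,_; proj₂)
open import Data.Product.Properties using (≡-dec)
open import Data.Nat using (zero; suc; _+_; _*_; _∸_; _≤_; _<_; _≥_; z≤n; s≤s; _≟_; _<?_; _≤?_; _!)
open import Data.Nat.Properties
open import Data.Nat.ListAction using (sum; product)
open import Data.Nat.ListAction.Properties using (sum-++; product-++; sum-↭)
open import Data.Nat.Solver using (module +-*-Solver)
open import Data.Fin using (Fin)
import Data.Fin as Fin
import Data.Fin.Properties as Finₚ
open import Data.List
  using ([]; _∷_; [_]; _++_; length; concatMap; filter; cartesianProductWith; upTo; replicate; allFin; tabulate; lookup)
open import Data.List.Properties
  using (map-++; map-∘; map-cong; map-cong-local; length-map; ∷-injective; length-tabulate; map-tabulate; tabulate-lookup)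
open import Data.List.Relation.Unary.All as All using (All; []; _∷_)
open import Data.List.Relation.Unary.All.Properties using (all-filter; filter⁺; replicate⁺)
open import Data.List.Relation.Unary.All.Properties.Core using (All¬⇒¬Any; ¬All⇒Any¬)
import Data.List.Relation.Unary.All.Properties as Allₚ
open import Data.List.Relation.Unary.Any as Any using (Any; here; there)
open import Data.List.Relation.Unary.AllPairs as AllPairs using (AllPairs; []; _∷_)
import Data.List.Relation.Unary.AllPairs.Properties as AllPairsₚ
open import Data.List.Relation.Unary.Linked using (Linked; []; [-]; _∷_)
open import Data.List.Membership.Propositional using (find; lose)
open import Data.List.Membership.Propositional.Properties
  using ( ∈-map⁺; ∈-map⁻; ∈-filter⁺; ∈-filter⁻; ∈-allFin; ∈-upTo⁺; ∈-tabulate⁺; ∈-tabulate⁻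
        ; ∈-concatMap⁺; ∈-concatMap⁻; ∈-lookup; ∈-cartesianProductWith⁺)
open import Data.List.Membership.Propositional.Properties.WithK using (unique∧set⇒bag; unique⇒irrelevant)
open import Data.List.Relation.Unary.Unique.Propositional.Properties
  using (allFin⁺; upTo⁺; tabulate⁺; concat⁺; cartesianProductWith⁺) renaming (map⁺ to map⁺-unique)
import Data.List.Relation.Unary.Unique.Setoid.Properties as USetₚ
import Data.List.Relation.Unary.Enumerates.Setoid.Properties as Enumₚ
open import Data.List.Relation.Binary.BagAndSetEquality using (∼bag⇒↭)
open import Data.List.Relation.Binary.Permutation.Propositional using (_↭_; ↭-sym)
open import Data.List.Relation.Binary.Permutation.Propositional.Properties using (↭-length; filter-↭; All-resp-↭)
open import Relation.Binary.Properties.DecTotalOrder ≤-decTotalOrder using (≥-decTotalOrder)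
open import Data.List.Sort ≥-decTotalOrder using (sort; sort-↗; sort-↭)
open import Data.Rational as ℚ using (ℚ)
import Data.Rational.Properties as ℚₚ
import Data.Rational.Unnormalised as ℚᵘ
import Data.Rational.Unnormalised.Properties as ℚᵘₚ
import Data.Integer as ℤ
import Data.Integer.Properties as ℤₚ
open import Function.Bundles using (Bijection; mk⇔)
open import Relation.Nullary using (Dec; yes; no; ¬_)
open import Relation.Nullary.Decidable using (_×-dec_; map′)
open import Relation.Unary using (Decidable)
open import Relation.Binary.Bundles using (Setoid)
open import Relation.Binary.Definitions using (DecidableEquality; tri<; tri≈; tri>)
open import Relation.Binary.PropositionalEquality hiding ([_])

-- A proper q-colouring x of 𝒢(s(λ)) determines the marked map Γ with Γ(i)(c) = λ_i[r] when the copy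
-- i_r has colour c, and Γ(i)(c) = 0 when no copy of i has colour c. The type of a marked map Γ records,
-- for all i and k ≥ 1, the number of colours on which Γ(i) takes the value k. Counting the colourings
-- over a fixed Γ copy by copy gives a product of falling factorials, which is ∏_i ∏_k (d_k^{λ_i})! when Γ
-- has type λ and vanishes otherwise: the weighted sums ∑_k k·(number of colours with value k) and
-- ∑_k k·d_k^{λ_i} both equal m_i, so a mismatch leaves some value with too few colours. Hence
-- π_{𝒢(s(λ))}(q) / ∏ d! counts the marked maps of type λ, and as every marked map has exactly one type,
-- summing over S(m) counts all of them.

private variable
  A B : Set
  xs : List A

-- Sums and products over lists


∑ : List A → (A → ℕ) → ℕ
∑ xs f = sum (map f xs)

∏ : List A → (A → ℕ) → ℕ
∏ xs f = product (map f xs)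

syntax ∑ xs (λ x → e) = ∑[ x ∈ xs ] e
syntax ∏ xs (λ x → e) = ∏[ x ∈ xs ] e

module _ {f g : A → ℕ} where

  ∑-cong : ∀ xs → (∀ {x} → x ∈ xs → f x ≡ g x) → ∑ xs f ≡ ∑ xs g
  ∑-cong _ f≡g = cong sum (map-cong-local (All.tabulate f≡g))

  ∏-cong : ∀ xs → (∀ {x} → x ∈ xs → f x ≡ g x) → ∏ xs f ≡ ∏ xs g
  ∏-cong _ f≡g = cong product (map-cong-local (All.tabulate f≡g))

  ∑-distrib-+ : ∀ xs → ∑[ x ∈ xs ] (f x + g x) ≡ ∑ xs f + ∑ xs g
  ∑-distrib-+ []       = refl
  ∑-distrib-+ (x ∷ xs) = begin
    f x + g x + ∑[ y ∈ xs ] (f y + g y) ≡⟨ cong (f x + g x +_) (∑-distrib-+ xs) ⟩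
    f x + g x + (∑ xs f + ∑ xs g)
      ≡⟨ solve 4 (λ a b s t → a :+ b :+ (s :+ t) := a :+ s :+ (b :+ t)) refl (f x) (g x) (∑ xs f) (∑ xs g) ⟩
    f x + ∑ xs f + (g x + ∑ xs g)       ∎
    where
    open ≡-Reasoning
    open +-*-Solver

module _ (f : A → ℕ) where

  ∑-++ : ∀ xs ys → ∑ (xs ++ ys) f ≡ ∑ xs f + ∑ ys f
  ∑-++ xs ys = trans (cong sum (map-++ f xs ys)) (sum-++ (map f xs) (map f ys))

  ∏-++ : ∀ xs ys → ∏ (xs ++ ys) f ≡ ∏ xs f * ∏ ys f
  ∏-++ xs ys = trans (cong product (map-++ f xs ys)) (product-++ (map f xs) (map f ys))

  ∑-concatMap : (g : B → List A) (ys : List B) → ∑ (concatMap g ys) f ≡ ∑[ y ∈ ys ] ∑ (g y) f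
  ∑-concatMap g []       = refl
  ∑-concatMap g (y ∷ ys) = trans (∑-++ (g y) (concatMap g ys)) (cong (∑ (g y) f +_) (∑-concatMap g ys))

  ∏-concatMap : (g : B → List A) (ys : List B) → ∏ (concatMap g ys) f ≡ ∏[ y ∈ ys ] ∏ (g y) f
  ∏-concatMap g []       = refl
  ∏-concatMap g (y ∷ ys) = trans (∏-++ (g y) (concatMap g ys)) (cong (∏ (g y) f *_) (∏-concatMap g ys))

  ∑-map : (g : B → A) (ys : List B) → ∑ (map g ys) f ≡ ∑[ y ∈ ys ] f (g y)
  ∑-map g ys = cong sum (sym (map-∘ ys))

  ∏-map : (g : B → A) (ys : List B) → ∏ (map g ys) f ≡ ∏[ y ∈ ys ] f (g y)
  ∏-map g ys = cong product (sym (map-∘ ys))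

  ∑-cartesianProductWith : {C : Set} (g : B → C → A) (ys : List B) (zs : List C) →
                           ∑ (cartesianProductWith g ys zs) f ≡ ∑[ y ∈ ys ] ∑[ z ∈ zs ] f (g y z)
  ∑-cartesianProductWith g []       zs = refl
  ∑-cartesianProductWith g (y ∷ ys) zs =
    trans (∑-++ (map (g y) zs) _) (cong₂ _+_ (∑-map (g y) zs) (∑-cartesianProductWith g ys zs))

  *-distribˡ-∑ : ∀ k xs → ∑[ x ∈ xs ] (k * f x) ≡ k * ∑ xs f
  *-distribˡ-∑ k []       = sym (*-zeroʳ k)
  *-distribˡ-∑ k (x ∷ xs) = trans (cong (k * f x +_) (*-distribˡ-∑ k xs)) (sym (*-distribˡ-+ k (f x) _))

  ∑-zero : ∀ xs → (∀ {x} → x ∈ xs → f x ≡ 0) → ∑ xs f ≡ 0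
  ∑-zero []       _   = refl
  ∑-zero (x ∷ xs) f≡0 = cong₂ _+_ (f≡0 (here refl)) (∑-zero xs (λ x∈ → f≡0 (there x∈)))

  ∏-zero : Any (λ x → f x ≡ 0) xs → ∏ xs f ≡ 0
  ∏-zero {xs = x ∷ xs} (here fx≡0) = cong (_* ∏ xs f) fx≡0
  ∏-zero {xs = x ∷ xs} (there p)   = trans (cong (f x *_) (∏-zero p)) (*-zeroʳ (f x))

∑-comm : (xs : List A) (ys : List B) (f : A → B → ℕ) →
         ∑[ x ∈ xs ] ∑[ y ∈ ys ] f x y ≡ ∑[ y ∈ ys ] ∑[ x ∈ xs ] f x y
∑-comm []       ys f = sym (∑-zero (λ _ → 0) ys (λ _ → refl))
∑-comm (x ∷ xs) ys f = trans (cong (∑ ys (f x) +_) (∑-comm xs ys f)) (sym (∑-distrib-+ ys))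

∏-1 : (xs : List A) → ∏[ x ∈ xs ] 1 ≡ 1
∏-1 []       = refl
∏-1 (x ∷ xs) = trans (+-identityʳ _) (∏-1 xs)

∑-1≡length : (xs : List A) → ∑[ x ∈ xs ] 1 ≡ length xs
∑-1≡length []       = refl
∑-1≡length (x ∷ xs) = cong suc (∑-1≡length xs)

∏-positive : (xs : List A) (f : A → ℕ) → (∀ x → 1 ≤ f x) → 1 ≤ ∏ xs f
∏-positive []       f 1≤f = s≤s z≤n
∏-positive (x ∷ xs) f 1≤f = *-mono-≤ (1≤f x) (∏-positive xs f 1≤f)

+-≤-≡⇒≡ : ∀ {a b c d} → a ≤ b → c ≤ d → a + c ≡ b + d → a ≡ b × c ≡ d
+-≤-≡⇒≡ {a} {b} {c} {d} a≤b c≤d eq = a≡b , +-cancelˡ-≡ a c d (trans eq (cong (_+ d) (sym a≡b)))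
  where
  a≡b : a ≡ b
  a≡b = ≤-antisym a≤b (+-cancelʳ-≤ c b a (≤-trans (+-monoʳ-≤ b c≤d) (≤-reflexive (sym eq))))

module _ {f g : A → ℕ} where

  ∑-mono-≤ : All (λ x → f x ≤ g x) xs → ∑ xs f ≤ ∑ xs g
  ∑-mono-≤ []       = z≤n
  ∑-mono-≤ (p ∷ ps) = +-mono-≤ p (∑-mono-≤ ps)

  ∑-≤-≡⇒≡ : All (λ x → f x ≤ g x) xs → ∑ xs f ≡ ∑ xs g → ∀ {x} → x ∈ xs → f x ≡ g x
  ∑-≤-≡⇒≡ (p ∷ ps) eq (here refl) = proj₁ (+-≤-≡⇒≡ p (∑-mono-≤ ps) eq)
  ∑-≤-≡⇒≡ (p ∷ ps) eq (there x∈) = ∑-≤-≡⇒≡ ps (proj₂ (+-≤-≡⇒≡ p (∑-mono-≤ ps) eq)) x∈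

term≤∑ : (f : A → ℕ) → ∀ {x} → x ∈ xs → f x ≤ ∑ xs f
term≤∑ {xs = y ∷ ys} f (here refl) = m≤m+n (f y) _
term≤∑ {xs = y ∷ ys} f (there x∈) = ≤-trans (term≤∑ f x∈) (m≤n+m _ (f y))

private
  ∉-tail : ∀ {x : A} → Unique (x ∷ xs) → ∀ {y} → y ∈ xs → y ≢ x
  ∉-tail (x≢xs ∷ _) y∈ refl = All¬⇒¬Any x≢xs y∈

module _ {f g : A → ℕ} where

  ∑-differ-at : ∀ {c} → Unique xs → c ∈ xs → (∀ {x} → x ∈ xs → x ≢ c → f x ≡ g x) →
                ∑ xs f + g c ≡ ∑ xs g + f c
  ∑-differ-at {xs = x ∷ xs} u (here refl) f≡g = begin
    f x + ∑ xs f + g x ≡⟨ cong (λ s → f x + s + g x) (∑-cong xs (λ y∈ → f≡g (there y∈) (∉-tail u y∈))) ⟩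
    f x + ∑ xs g + g x ≡⟨ solve 3 (λ a s b → a :+ s :+ b := b :+ s :+ a) refl (f x) (∑ xs g) (g x) ⟩
    g x + ∑ xs g + f x ∎
    where
    open ≡-Reasoning
    open +-*-Solver
  ∑-differ-at {xs = x ∷ xs} {c = c} u@(_ ∷ u′) (there c∈) f≡g = begin
    f x + ∑ xs f + g _   ≡⟨ +-assoc (f x) _ _ ⟩
    f x + (∑ xs f + g _) ≡⟨ cong₂ _+_ (f≡g (here refl) x≢c) (∑-differ-at u′ c∈ (λ y∈ → f≡g (there y∈))) ⟩
    g x + (∑ xs g + f _) ≡⟨ +-assoc (g x) _ _ ⟨
    g x + ∑ xs g + f _   ∎
    where
    open ≡-Reasoning
    x≢c : x ≢ c
    x≢c x≡c = ∉-tail u c∈ (sym x≡c)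

  ∏-differ-at : ∀ {c} s → Unique xs → c ∈ xs → (∀ {x} → x ∈ xs → x ≢ c → f x ≡ g x) →
                f c ≡ s * g c → ∏ xs f ≡ s * ∏ xs g
  ∏-differ-at {xs = x ∷ xs} s u (here refl) f≡g fc≡sgc = begin
    f x * ∏ xs f       ≡⟨ cong₂ _*_ fc≡sgc (∏-cong xs (λ y∈ → f≡g (there y∈) (∉-tail u y∈))) ⟩
    s * g x * ∏ xs g   ≡⟨ *-assoc s _ _ ⟩
    s * (g x * ∏ xs g) ∎
    where open ≡-Reasoning
  ∏-differ-at {xs = x ∷ xs} {c = c} s u@(_ ∷ u′) (there c∈) f≡g fc≡sgc = begin
    f x * ∏ xs f       ≡⟨ cong₂ _*_ (f≡g (here refl) x≢c) (∏-differ-at s u′ c∈ (λ y∈ → f≡g (there y∈)) fc≡sgc) ⟩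
    g x * (s * ∏ xs g) ≡⟨ solve 3 (λ a s p → a :* (s :* p) := s :* (a :* p)) refl (g x) s (∏ xs g) ⟩
    s * (g x * ∏ xs g) ∎
    where
    open ≡-Reasoning
    open +-*-Solver
    x≢c : x ≢ c
    x≢c x≡c = ∉-tail u c∈ (sym x≡c)

∑-single : (f : A → ℕ) → ∀ {c} → Unique xs → c ∈ xs → (∀ {x} → x ∈ xs → x ≢ c → f x ≡ 0) → ∑ xs f ≡ f c
∑-single {xs = xs} f {c} u c∈ f≡0 = begin
  ∑ xs f                    ≡⟨ +-identityʳ _ ⟨
  ∑ xs f + 0                ≡⟨ ∑-differ-at u c∈ f≡0 ⟩
  ∑[ x ∈ xs ] 0 + f c       ≡⟨ cong (_+ f c) (∑-zero (λ _ → 0) xs (λ _ → refl)) ⟩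
  f c                       ∎
  where open ≡-Reasoning

Unique-concatMap : (f : A → List B) → Unique xs → (∀ x → Unique (f x)) →
                   (∀ {x y b} → b ∈ f x → b ∈ f y → x ≡ y) → Unique (concatMap f xs)
Unique-concatMap f xs! f! disjoint = concat⁺ (Allₚ.map⁺ (All.tabulate (λ {x} _ → f! x)))
  (AllPairsₚ.map⁺ (AllPairs.map (λ x≢y {_} (b∈fx , b∈fy) → x≢y (disjoint b∈fx b∈fy)) xs!))

map-cong-local⁻ : {f g : A → B} → map f xs ≡ map g xs → All (λ x → f x ≡ g x) xs
map-cong-local⁻ {xs = []}     _  = []
map-cong-local⁻ {xs = x ∷ xs} eq = proj₁ (∷-injective eq) ∷ map-cong-local⁻ (proj₂ (∷-injective eq))

AllPairs-lookup : {R : A → A → Set} → (∀ {x y} → R x y → R y x) → AllPairs R xs →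
                  ∀ {x y} → x ∈ xs → y ∈ xs → x ≢ y → R x y
AllPairs-lookup sym-R (_ ∷ _)     (here refl) (here refl) x≢y = ⊥-elim (x≢y refl)
AllPairs-lookup sym-R (Rx ∷ _)    (here refl) (there y∈)  _   = All.lookup Rx y∈
AllPairs-lookup sym-R (Rx ∷ _)    (there x∈)  (here refl) _   = sym-R (All.lookup Rx x∈)
AllPairs-lookup sym-R (_ ∷ Rxs)   (there x∈)  (there y∈)  x≢y = AllPairs-lookup sym-R Rxs x∈ y∈ x≢y

module _ (_≟A_ : DecidableEquality A) where

  zipLookup : (ws : List A) (cs : List B) → length cs ≡ length ws → ∀ {a} → a ∈ ws → B
  zipLookup (w ∷ ws) (c ∷ cs) eq {a} a∈ with a ≟A w
  ... | yes _   = c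
  ... | no  a≢w = zipLookup ws cs (suc-injective eq) (Any.tail a≢w a∈)

  map-zipLookup : ∀ {ws} → Unique ws → (cs : List B) (eq : length cs ≡ length ws) →
                  (f : A → B) → (∀ {a} (a∈ : a ∈ ws) → f a ≡ zipLookup ws cs eq a∈) → map f ws ≡ cs
  map-zipLookup {ws = []}     _              []       _  f _  = refl
  map-zipLookup {ws = w ∷ ws} ws!@(_ ∷ ws!′) (c ∷ cs) eq f f≡ =
    cong₂ _∷_ head (map-zipLookup ws!′ cs (suc-injective eq) f tail)
    where
    head : f w ≡ c
    head with w ≟A w | f≡ (here refl)
    ... | yes _   | fw≡c = fw≡c
    ... | no  w≢w | _    = ⊥-elim (w≢w refl)
    tail : ∀ {a} (a∈ : a ∈ ws) → f a ≡ zipLookup ws cs (suc-injective eq) a∈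
    tail {a} a∈ with a ≟A w | f≡ (there a∈)
    ... | yes refl | _    = ⊥-elim (∉-tail ws! a∈ refl)
    ... | no  _    | fa≡p = fa≡p

-- Counting

𝟙 : {P : Set} → Dec P → ℕ
𝟙 (yes _) = 1
𝟙 (no _)  = 0

module _ {P : Set} where

  𝟙-yes : (P? : Dec P) → P → 𝟙 P? ≡ 1
  𝟙-yes (yes _) _ = refl
  𝟙-yes (no ¬p) p = ⊥-elim (¬p p)

  𝟙-no : (P? : Dec P) → ¬ P → 𝟙 P? ≡ 0
  𝟙-no (yes p) ¬p = ⊥-elim (¬p p)
  𝟙-no (no _)  _  = refl

  𝟙-cong : {Q : Set} (P? : Dec P) (Q? : Dec Q) → (P → Q) → (Q → P) → 𝟙 P? ≡ 𝟙 Q?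
  𝟙-cong (yes _) (yes _) _   _   = refl
  𝟙-cong (yes p) (no ¬q) p→q _   = ⊥-elim (¬q (p→q p))
  𝟙-cong (no ¬p) (yes q) _   q→p = ⊥-elim (¬p (q→p q))
  𝟙-cong (no _)  (no _)  _   _   = refl

  𝟙-× : {Q : Set} (P? : Dec P) (Q? : Dec Q) → 𝟙 (P? ×-dec Q?) ≡ 𝟙 P? * 𝟙 Q?
  𝟙-× (yes _) (yes _) = refl
  𝟙-× (yes _) (no _)  = refl
  𝟙-× (no _)  _       = refl

count : {P : A → Set} → Decidable P → List A → ℕ
count P? xs = ∑[ x ∈ xs ] 𝟙 (P? x)

module _ {P : A → Set} (P? : Decidable P) where

  count≡length∘filter : ∀ xs → count P? xs ≡ length (filter P? xs)
  count≡length∘filter []       = refl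
  count≡length∘filter (x ∷ xs) with P? x
  ... | yes _ = cong suc (count≡length∘filter xs)
  ... | no  _ = count≡length∘filter xs

  count-↭ : ∀ {xs ys} → xs ↭ ys → count P? xs ≡ count P? ys
  count-↭ {xs} {ys} xs↭ys = begin
    count P? xs              ≡⟨ count≡length∘filter xs ⟩
    length (filter P? xs)    ≡⟨ ↭-length (filter-↭ P? xs↭ys) ⟩
    length (filter P? ys)    ≡⟨ count≡length∘filter ys ⟨
    count P? ys              ∎
    where open ≡-Reasoning

  count-none : All (λ x → ¬ P x) xs → count P? xs ≡ 0
  count-none {xs} ¬ps = ∑-zero _ xs (λ x∈ → 𝟙-no (P? _) (All.lookup ¬ps x∈))

  ∑-𝟙*-constant : ∀ xs (f : A → ℕ) k → (∀ {x} → P x → f x ≡ k) →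
                  ∑[ x ∈ xs ] (𝟙 (P? x) * f x) ≡ count P? xs * k
  ∑-𝟙*-constant []       f k f≡k = refl
  ∑-𝟙*-constant (x ∷ xs) f k f≡k with P? x
  ... | yes px = cong₂ _+_ (trans (+-identityʳ (f x)) (f≡k px)) (∑-𝟙*-constant xs f k f≡k)
  ... | no  _  = ∑-𝟙*-constant xs f k f≡k

∏-𝟙* : {P : A → Set} (P? : Decidable P) (f : A → ℕ) (xs : List A) →
        ∏[ x ∈ xs ] (𝟙 (P? x) * f x) ≡ 𝟙 (All.all? P? xs) * ∏ xs f
∏-𝟙* P? f []       = refl
∏-𝟙* P? f (x ∷ xs) with P? x | All.all? P? xs | ∏-𝟙* P? f xs
... | no  _ | _     | _  = refl
... | yes _ | no  _ | ih = trans (cong ((f x + 0) *_) ih) (*-zeroʳ (f x + 0))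
... | yes _ | yes _ | ih = trans (cong₂ _*_ (+-identityʳ (f x)) (trans ih (+-identityʳ (∏ xs f)))) (sym (+-identityʳ _))

length≡∑-fibres : {R : A → B → Set} (R? : ∀ x y → Dec (R x y)) (xs : List A) (ys : List B) →
                  (∀ {x} → x ∈ xs → count (R? x) ys ≡ 1) →
                  length xs ≡ ∑[ y ∈ ys ] count (λ x → R? x y) xs
length≡∑-fibres R? xs ys one = begin
  length xs                                  ≡⟨ ∑-1≡length xs ⟨
  ∑[ x ∈ xs ] 1                              ≡⟨ ∑-cong xs (λ x∈ → sym (one x∈)) ⟩
  ∑[ x ∈ xs ] ∑[ y ∈ ys ] 𝟙 (R? x y)         ≡⟨ ∑-comm xs ys (λ x y → 𝟙 (R? x y)) ⟩
  ∑[ y ∈ ys ] ∑[ x ∈ xs ] 𝟙 (R? x y)         ∎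
  where open ≡-Reasoning

module _ (S : Setoid 0ℓ 0ℓ) where
  open Setoid S using (_≈_) renaming (Carrier to C)

  IsListing : List C → Set
  IsListing xs = USet.Unique S xs × Enum.IsEnumeration S xs

  count≡1 : {P : C → Set} (P? : Decidable P) {xs : List C} → USet.Unique S xs →
            (∀ {x y} → P x → P y → x ≈ y) → Any P xs → count P? xs ≡ 1
  count≡1 P? (x≉xs ∷ _) P-unique (here px) =
    cong₂ _+_ (𝟙-yes (P? _) px) (count-none P? (All.map (λ x≉y py → x≉y (P-unique px py)) x≉xs))
  count≡1 {P = P} P? (x≉xs ∷ xs!) P-unique (there p) =
    cong₂ _+_ (𝟙-no (P? _) ¬px) (count≡1 P? xs! P-unique p)
    where
    ¬px : ¬ P _
    ¬px px = All¬⇒¬Any (All.map (λ x≉y py → x≉y (P-unique px py)) x≉xs) p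

  count-transport : {B : Set} {Q : B → Set} (Q? : Decidable Q) (h : C → B) →
                    (∀ {x y} → h x ≡ h y → x ≈ y) → (∀ {x y} → x ≈ y → h x ≡ h y) →
                    {xs : List C} → IsListing xs →
                    {ys : List B} → Unique ys → (∀ {y} → Q y → y ∈ ys) → (∀ {y} → Q y → ∃ λ x → h x ≡ y) →
                    count (λ x → Q? (h x)) xs ≡ count Q? ys
  count-transport {B = B} {Q = Q} Q? h h-inj h-cong {xs} (xs! , xs-complete) {ys} ys! Q⊆ys Q⊆image = begin
    count Qh? xs                    ≡⟨ count≡length∘filter Qh? xs ⟩
    length (filter Qh? xs)          ≡⟨ length-map h (filter Qh? xs) ⟨
    length (map h (filter Qh? xs))  ≡⟨ ↭-length (∼bag⇒↭ (unique∧set⇒bag image! (USetₚ.filter⁺ (setoid B) Q? ys!) (mk⇔ ⊆ ⊇))) ⟩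
    length (filter Q? ys)           ≡⟨ count≡length∘filter Q? ys ⟨
    count Q? ys                     ∎
    where
    open ≡-Reasoning
    Qh? : Decidable (λ x → Q (h x))
    Qh? x = Q? (h x)
    image! : Unique (map h (filter Qh? xs))
    image! = USetₚ.map⁺ S (setoid B) h-inj (USetₚ.filter⁺ S Qh? xs!)
    ⊆ : ∀ {y} → y ∈ map h (filter Qh? xs) → y ∈ filter Q? ys
    ⊆ y∈ with x , x∈ , refl ← ∈-map⁻ h y∈ with qhx ← proj₂ (∈-filter⁻ Qh? {xs = xs} x∈) =
      ∈-filter⁺ Q? (Q⊆ys qhx) qhx
    ⊇ : ∀ {y} → y ∈ filter Q? ys → y ∈ map h (filter Qh? xs)
    ⊇ y∈ with qy ← proj₂ (∈-filter⁻ Q? {xs = ys} y∈) with Q⊆image qy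
    ... | x , refl with x′ , x′∈ , x≈x′ ← find (xs-complete x) =
      subst (_∈ map h (filter Qh? xs)) (sym (h-cong x≈x′)) (∈-map⁺ h (∈-filter⁺ Qh? x′∈ (subst Q (h-cong x≈x′) qy)))

  HasCard⇒listing : ∀ {n} → HasCard S n → Σ (List C) λ xs → length xs ≡ n × IsListing xs
  HasCard⇒listing {n} bij = map to (allFin n)
                          , trans (length-map to (allFin n)) (length-tabulate (λ i → i))
                          , USetₚ.map⁺ (setoid (Fin n)) S injective (allFin⁺ n)
                          , Enumₚ.map⁺ (setoid (Fin n)) S surjection (λ i → ∈-allFin i)
    where open Bijection bij

-- Falling factorials, multiplicities and partitions

fallingFactorial : ℕ → ℕ → ℕ
fallingFactorial n       zero    = 1
fallingFactorial zero    (suc k) = 0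
fallingFactorial (suc n) (suc k) = suc n * fallingFactorial n k

fallingFactorial-suc : ∀ n k → fallingFactorial n (suc k) ≡ n * fallingFactorial (n ∸ 1) k
fallingFactorial-suc zero    k = refl
fallingFactorial-suc (suc n) k = refl

fallingFactorial-n-n≡n! : ∀ n → fallingFactorial n n ≡ n !
fallingFactorial-n-n≡n! zero    = refl
fallingFactorial-n-n≡n! (suc n) = cong (suc n *_) (fallingFactorial-n-n≡n! n)

fallingFactorial-< : ∀ {n k} → n < k → fallingFactorial n k ≡ 0
fallingFactorial-< {zero}  {suc k} _         = refl
fallingFactorial-< {suc n} {suc k} (s≤s n<k) = trans (cong (suc n *_) (fallingFactorial-< n<k)) (*-zeroʳ (suc n))

multiplicity : ℕ → List ℕ → ℕ
multiplicity k = count (_≟ k)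

∑-weighted-indicator : ∀ M v → v ≤ M → ∑[ j ∈ upTo M ] (suc j * 𝟙 (v ≟ suc j)) ≡ v
∑-weighted-indicator M zero    _   = ∑-zero _ (upTo M) (λ {j} _ → *-zeroʳ (suc j))
∑-weighted-indicator M (suc v) v<M = begin
  ∑[ j ∈ upTo M ] (suc j * 𝟙 (suc v ≟ suc j)) ≡⟨ ∑-single _ (upTo⁺ M) (∈-upTo⁺ v<M) off-v ⟩
  suc v * 𝟙 (suc v ≟ suc v)                   ≡⟨ cong (suc v *_) (𝟙-yes (suc v ≟ suc v) refl) ⟩
  suc v * 1                                   ≡⟨ *-identityʳ (suc v) ⟩
  suc v                                       ∎
  where
  open ≡-Reasoning
  off-v : ∀ {j} → j ∈ upTo M → j ≢ v → suc j * 𝟙 (suc v ≟ suc j) ≡ 0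
  off-v {j} _ j≢v = trans (cong (suc j *_) (𝟙-no (suc v ≟ suc j) (λ e → j≢v (sym (suc-injective e))))) (*-zeroʳ (suc j))

∑-weighted-multiplicity : ∀ M vs → All (_≤ M) vs → ∑[ j ∈ upTo M ] (suc j * multiplicity (suc j) vs) ≡ sum vs
∑-weighted-multiplicity M []       _          = ∑-zero _ (upTo M) (λ {j} _ → *-zeroʳ (suc j))
∑-weighted-multiplicity M (v ∷ vs) (v≤M ∷ vs≤M) = begin
  ∑[ j ∈ upTo M ] (suc j * (𝟙 (v ≟ suc j) + multiplicity (suc j) vs))
    ≡⟨ ∑-cong (upTo M) (λ {j} _ → *-distribˡ-+ (suc j) (𝟙 (v ≟ suc j)) _) ⟩
  ∑[ j ∈ upTo M ] (suc j * 𝟙 (v ≟ suc j) + suc j * multiplicity (suc j) vs)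
    ≡⟨ ∑-distrib-+ (upTo M) ⟩
  ∑[ j ∈ upTo M ] (suc j * 𝟙 (v ≟ suc j)) + ∑[ j ∈ upTo M ] (suc j * multiplicity (suc j) vs)
    ≡⟨ cong₂ _+_ (∑-weighted-indicator M v v≤M) (∑-weighted-multiplicity M vs vs≤M) ⟩
  v + sum vs ∎
  where open ≡-Reasoning

∑-weighted-≤-≡⇒≡ : ∀ js (a b : ℕ → ℕ) → All (λ j → a j ≤ b j) js →
                   ∑[ j ∈ js ] (suc j * a j) ≡ ∑[ j ∈ js ] (suc j * b j) → All (λ j → a j ≡ b j) js
∑-weighted-≤-≡⇒≡ js a b a≤b eq = All.tabulate λ {j} j∈ →
  *-cancelˡ-≡ (a j) (b j) (suc j) (∑-≤-≡⇒≡ (All.map (λ {j} → *-monoʳ-≤ (suc j)) a≤b) eq j∈)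

multiplicity-> : ∀ k vs → All (_< k) vs → multiplicity k vs ≡ 0
multiplicity-> k vs vs<k = count-none (_≟ k) (All.map <⇒≢ vs<k)

private
  head≥ : ∀ {x xs} → Linked _≥_ (x ∷ xs) → All (_≤ x) (x ∷ xs)
  head≥ {x} = go ≤-refl
    where
    go : ∀ {y ys} → y ≤ x → Linked _≥_ (y ∷ ys) → All (_≤ x) (y ∷ ys)
    go y≤x [-]           = y≤x ∷ []
    go y≤x (y≥z ∷ sorted) = y≤x ∷ go (≤-trans y≥z y≤x) sorted

  Linked-tail : ∀ {x xs} → Linked _≥_ (x ∷ xs) → Linked _≥_ xs
  Linked-tail [-]     = []
  Linked-tail (_ ∷ l) = l

  multiplicity-head : ∀ x xs → multiplicity x (x ∷ xs) ≡ suc (multiplicity x xs)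
  multiplicity-head x xs = cong (_+ multiplicity x xs) (𝟙-yes (x ≟ x) refl)

sorted-multiplicity-injective : ∀ xs ys → Linked _≥_ xs → Linked _≥_ ys →
                                (∀ k → multiplicity k xs ≡ multiplicity k ys) → xs ≡ ys
sorted-multiplicity-injective []       []       _  _  _    = refl
sorted-multiplicity-injective []       (y ∷ ys) _  _  mult = ⊥-elim (0≢1+n (trans (mult y) (multiplicity-head y ys)))
sorted-multiplicity-injective (x ∷ xs) []       _  _  mult = ⊥-elim (0≢1+n (trans (sym (mult x)) (multiplicity-head x xs)))
sorted-multiplicity-injective (x ∷ xs) (y ∷ ys) sx sy mult with <-cmp x y
... | tri< x<y _ _ = ⊥-elim (0≢1+n (begin
  0                            ≡⟨ multiplicity-> y (x ∷ xs) (All.map (λ z≤x → ≤-<-trans z≤x x<y) (head≥ sx)) ⟨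
  multiplicity y (x ∷ xs)      ≡⟨ mult y ⟩
  multiplicity y (y ∷ ys)      ≡⟨ multiplicity-head y ys ⟩
  suc (multiplicity y ys)      ∎))
  where open ≡-Reasoning
... | tri> _ _ x>y = ⊥-elim (0≢1+n (begin
  0                            ≡⟨ multiplicity-> x (y ∷ ys) (All.map (λ z≤y → ≤-<-trans z≤y x>y) (head≥ sy)) ⟨
  multiplicity x (y ∷ ys)      ≡⟨ mult x ⟨
  multiplicity x (x ∷ xs)      ≡⟨ multiplicity-head x xs ⟩
  suc (multiplicity x xs)      ∎))
  where open ≡-Reasoning
... | tri≈ _ refl _ = cong (x ∷_) (sorted-multiplicity-injective xs ys (Linked-tail sx) (Linked-tail sy)
                        (λ k → +-cancelˡ-≡ (𝟙 (x ≟ k)) _ _ (mult k)))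

part≤sum : ∀ vs → All (_≤ sum vs) vs
part≤sum []       = []
part≤sum (v ∷ vs) = m≤m+n v (sum vs) ∷ All.map (λ v≤ → ≤-trans v≤ (m≤n+m (sum vs) v)) (part≤sum vs)

positive-sum≡0⇒[] : ∀ vs → All (0 <_) vs → sum vs ≡ 0 → vs ≡ []
positive-sum≡0⇒[] []       _         _   = refl
positive-sum≡0⇒[] (v ∷ vs) (0<v ∷ _) eq = ⊥-elim (<⇒≢ (≤-trans 0<v (m≤m+n v (sum vs))) (sym eq))

all≡1⇒replicate : ∀ vs → All (_≡ 1) vs → vs ≡ replicate (sum vs) 1
all≡1⇒replicate []       []          = refl
all≡1⇒replicate (v ∷ vs) (refl ∷ ps) = cong (1 ∷_) (all≡1⇒replicate vs ps)

partitionOf : List ℕ → List ℕ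
partitionOf vs = sort (filter (0 <?_) vs)

module _ (vs : List ℕ) where

  partitionOf-descending : Linked _≥_ (partitionOf vs)
  partitionOf-descending = sort-↗ (filter (0 <?_) vs)

  partitionOf-All : {P : ℕ → Set} → All P vs → All P (partitionOf vs)
  partitionOf-All Pvs = All-resp-↭ (↭-sym (sort-↭ _)) (filter⁺ (0 <?_) Pvs)

  partitionOf-positive : All (0 <_) (partitionOf vs)
  partitionOf-positive = All-resp-↭ (↭-sym (sort-↭ _)) (all-filter (0 <?_) vs)

  sum-partitionOf : sum (partitionOf vs) ≡ sum vs
  sum-partitionOf = trans (sum-↭ (sort-↭ _)) (sum-filter vs)
    where
    sum-filter : ∀ us → sum (filter (0 <?_) us) ≡ sum us
    sum-filter []           = refl
    sum-filter (zero  ∷ us) = sum-filter us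
    sum-filter (suc u ∷ us) = cong (suc u +_) (sum-filter us)

  multiplicity-partitionOf : ∀ k → 0 < k → multiplicity k (partitionOf vs) ≡ multiplicity k vs
  multiplicity-partitionOf k 0<k = trans (count-↭ (_≟ k) (sort-↭ _)) (multiplicity-filter vs)
    where
    multiplicity-filter : ∀ us → multiplicity k (filter (0 <?_) us) ≡ multiplicity k us
    multiplicity-filter []           = refl
    multiplicity-filter (zero  ∷ us) = trans (multiplicity-filter us) (cong (_+ multiplicity k us) (sym (𝟙-no (0 ≟ k) (<⇒≢ 0<k))))
    multiplicity-filter (suc u ∷ us) = cong (𝟙 (suc u ≟ k) +_) (multiplicity-filter us)

sumFin≡∑ : ∀ {q} (f : Fin q → ℕ) → sumFin f ≡ ∑ (allFin q) f
sumFin≡∑ {zero}  f = refl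
sumFin≡∑ {suc q} f = cong (f Fin.zero +_) (begin
  sumFin (λ c → f (Fin.suc c))        ≡⟨ sumFin≡∑ (λ c → f (Fin.suc c)) ⟩
  sum (map (λ c → f (Fin.suc c)) (allFin q)) ≡⟨ cong sum (map-tabulate (λ c → c) (λ c → f (Fin.suc c))) ⟩
  sum (tabulate (λ c → f (Fin.suc c)))       ≡⟨ cong sum (map-tabulate Fin.suc f) ⟨
  sum (map f (tabulate Fin.suc))             ∎)
  where open ≡-Reasoning

module _ {n : ℕ} {λs : List ℕ} (partition : IsPartition n λs) where

  partition-parts≤ : All (_≤ n) λs
  partition-parts≤ = subst (λ s → All (_≤ s) λs) (proj₂ (proj₂ partition)) (part≤sum λs)

  partition-of-0 : n ≡ 0 → λs ≡ []
  partition-of-0 n≡0 = positive-sum≡0⇒[] λs (proj₁ (proj₂ partition)) (trans (proj₂ (proj₂ partition)) n≡0)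

∏-fallingFactorial : ∀ js (e d : ℕ → ℕ) → ∑[ j ∈ js ] (suc j * e j) ≡ ∑[ j ∈ js ] (suc j * d j) →
                     ∏[ j ∈ js ] fallingFactorial (e j) (d j) ≡ 𝟙 (All.all? (λ j → e j ≟ d j) js) * ∏[ j ∈ js ] (d j !)
∏-fallingFactorial js e d same-weight with All.all? (λ j → e j ≟ d j) js
... | yes e≡d = trans (∏-cong js λ {j} j∈ → trans (cong (λ n → fallingFactorial n (d j)) (All.lookup e≡d j∈))
                                                   (fallingFactorial-n-n≡n! (d j)))
                      (sym (+-identityʳ _))
... | no  e≢d with All.all? (λ j → d j ≤? e j) js
...   | yes d≤e = ⊥-elim (e≢d (All.map sym (∑-weighted-≤-≡⇒≡ js d e d≤e (sym same-weight))))
...   | no  d≰e = ∏-zero _ (Any.map (λ d≰e → fallingFactorial-< (≰⇒> d≰e)) (¬All⇒Any¬ (λ j → d j ≤? e j) js d≰e))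

-- Rationals

frac-cancel : ∀ M D → 0 < D → frac (M * D) D ≡ fromℕ M
frac-cancel M (suc d) _ = ℚₚ.fromℚᵘ-cong {ℚᵘ.mkℚᵘ (ℤ.+ (M * suc d)) d} {ℚᵘ.mkℚᵘ (ℤ.+ M) 0}
  (ℚᵘ.*≡* (trans (ℤₚ.*-identityʳ (ℤ.+ (M * suc d))) (ℤₚ.pos-* M (suc d))))

fromℕ-+ : ∀ a b → fromℕ (a + b) ≡ fromℕ a ℚ.+ fromℕ b
fromℕ-+ a b = ℚₚ.toℚᵘ-injective (begin
  ℚ.toℚᵘ (fromℕ (a + b))                    ≈⟨ toℚᵘ-fromℕ (a + b) ⟩
  ℚᵘ.mkℚᵘ (ℤ.+ (a + b)) 0                   ≈⟨ ℚᵘ.*≡* (cong (ℤ._* ℤ.+ 1) (trans (ℤₚ.pos-+ a b)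
                                                 (sym (cong₂ ℤ._+_ (ℤₚ.*-identityʳ (ℤ.+ a)) (ℤₚ.*-identityʳ (ℤ.+ b)))))) ⟩
  ℚᵘ.mkℚᵘ (ℤ.+ a) 0 ℚᵘ.+ ℚᵘ.mkℚᵘ (ℤ.+ b) 0  ≈⟨ ℚᵘₚ.+-cong (toℚᵘ-fromℕ a) (toℚᵘ-fromℕ b) ⟨
  ℚ.toℚᵘ (fromℕ a) ℚᵘ.+ ℚ.toℚᵘ (fromℕ b)    ≈⟨ ℚₚ.toℚᵘ-homo-+ (fromℕ a) (fromℕ b) ⟨
  ℚ.toℚᵘ (fromℕ a ℚ.+ fromℕ b)              ∎)
  where
  open import Relation.Binary.Reasoning.Setoid ℚᵘₚ.≃-setoid
  toℚᵘ-fromℕ : ∀ n → ℚ.toℚᵘ (fromℕ n) ℚᵘ.≃ ℚᵘ.mkℚᵘ (ℤ.+ n) 0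
  toℚᵘ-fromℕ n = ℚₚ.toℚᵘ-fromℚᵘ (ℚᵘ.mkℚᵘ (ℤ.+ n) 0)

sumℚ-fromℕ : {A : Set} (xs : List A) (g : A → ℕ) → sumℚ (map (λ x → fromℕ (g x)) xs) ≡ fromℕ (∑ xs g)
sumℚ-fromℕ []       g = refl
sumℚ-fromℕ (x ∷ xs) g = trans (cong (fromℕ (g x) ℚ.+_) (sumℚ-fromℕ xs g)) (sym (fromℕ-+ (g x) (∑ xs g)))

module SequentialChoice {I : Set} (_≟I_ : DecidableEquality I) (q : ℕ) where

  Table : Set
  Table = I → Fin q → ℕ

  Label : Set
  Label = I × ℕ

  _≟L_ : DecidableEquality Label
  _≟L_ = ≡-dec _≟I_ _≟_

  _≟IC_ : DecidableEquality (I × Fin q)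
  _≟IC_ = ≡-dec _≟I_ Finₚ._≟_

  clear : Table → I → Fin q → Table
  clear Z i c j c′ with (j , c′) ≟IC (i , c)
  ... | yes _ = 0
  ... | no  _ = Z j c′

  clear-same : ∀ Z i c → clear Z i c i c ≡ 0
  clear-same Z i c with (i , c) ≟IC (i , c)
  ... | yes _   = refl
  ... | no  ≢ic = ⊥-elim (≢ic refl)

  clear-other : ∀ Z i c j c′ → (j , c′) ≢ (i , c) → clear Z i c j c′ ≡ Z j c′
  clear-other Z i c j c′ ≢ic with (j , c′) ≟IC (i , c)
  ... | yes ≡ic = ⊥-elim (≢ic ≡ic)
  ... | no  _   = refl

  clear-cong : ∀ {Z Z′} → (∀ j c′ → Z j c′ ≡ Z′ j c′) → ∀ i c j c′ → clear Z i c j c′ ≡ clear Z′ i c j c′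
  clear-cong Z≗Z′ i c j c′ with (j , c′) ≟IC (i , c)
  ... | yes _ = refl
  ... | no  _ = Z≗Z′ j c′

  -- The colours cs go, in order, to vertex copies labelled ls; a copy labelled (i , k) takes a colour c
  -- with Z i c ≡ k, after which the entry (i , c) is cleared: as labels are positive, this keeps c
  -- from being reused by another copy of i.
  Choice : Table → List Label → List (Fin q) → Set
  Choice Z []             []       = ⊤
  Choice Z ((i , k) ∷ ls) (c ∷ cs) = Z i c ≡ k × Choice (clear Z i c) ls cs
  Choice Z []             (_ ∷ _)  = ⊥
  Choice Z (_ ∷ _)        []       = ⊥

  choice? : ∀ Z ls cs → Dec (Choice Z ls cs)
  choice? Z []             []       = yes tt
  choice? Z ((i , k) ∷ ls) (c ∷ cs) = (Z i c ≟ k) ×-dec choice? (clear Z i c) ls cs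
  choice? Z []             (_ ∷ _)  = no λ ()
  choice? Z (_ ∷ _)        []       = no λ ()

  Choice-length : ∀ Z ls cs → Choice Z ls cs → length cs ≡ length ls
  Choice-length Z []             []       _         = refl
  Choice-length Z ((i , k) ∷ ls) (c ∷ cs) (_ , ch) = cong suc (Choice-length (clear Z i c) ls cs ch)

  Choice-cong : ∀ {Z Z′} → (∀ i c → Z i c ≡ Z′ i c) → ∀ ls cs → Choice Z ls cs → Choice Z′ ls cs
  Choice-cong Z≗Z′ []             []       _          = tt
  Choice-cong Z≗Z′ ((i , k) ∷ ls) (c ∷ cs) (Zic≡k , ch) =
    trans (sym (Z≗Z′ i c)) Zic≡k , Choice-cong (clear-cong Z≗Z′ i c) ls cs ch

  colourLists : ℕ → List (List (Fin q))
  colourLists zero    = [ [] ]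
  colourLists (suc n) = cartesianProductWith _∷_ (allFin q) (colourLists n)

  colourLists-complete : ∀ cs → cs ∈ colourLists (length cs)
  colourLists-complete []       = here refl
  colourLists-complete (c ∷ cs) = ∈-cartesianProductWith⁺ _∷_ (∈-allFin c) (colourLists-complete cs)

  colourLists-unique : ∀ n → Unique (colourLists n)
  colourLists-unique zero    = [] ∷ []
  colourLists-unique (suc n) = cartesianProductWith⁺ _∷_ ∷-injective (allFin⁺ q) (colourLists-unique n)

  choices : List Label → Table → ℕ
  choices ls Z = count (choice? Z ls) (colourLists (length ls))

  levelSize : Table → Label → ℕ
  levelSize Z (i , k) = count (λ c → Z i c ≟ k) (allFin q)

  choices-∷ : ∀ i k ls Z →
              choices ((i , k) ∷ ls) Z ≡ ∑[ c ∈ allFin q ] (𝟙 (Z i c ≟ k) * choices ls (clear Z i c))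
  choices-∷ i k ls Z = begin
    choices ((i , k) ∷ ls) Z
      ≡⟨ ∑-cartesianProductWith _ _∷_ (allFin q) (colourLists (length ls)) ⟩
    ∑[ c ∈ allFin q ] ∑[ cs ∈ colourLists (length ls) ] 𝟙 ((Z i c ≟ k) ×-dec choice? (clear Z i c) ls cs)
      ≡⟨ ∑-cong (allFin q) (λ {c} _ → ∑-cong (colourLists (length ls)) (λ {cs} _ → 𝟙-× (Z i c ≟ k) _)) ⟩
    ∑[ c ∈ allFin q ] ∑[ cs ∈ colourLists (length ls) ] (𝟙 (Z i c ≟ k) * 𝟙 (choice? (clear Z i c) ls cs))
      ≡⟨ ∑-cong (allFin q) (λ {c} _ → *-distribˡ-∑ _ (𝟙 (Z i c ≟ k)) (colourLists (length ls))) ⟩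
    ∑[ c ∈ allFin q ] (𝟙 (Z i c ≟ k) * choices ls (clear Z i c)) ∎
    where open ≡-Reasoning

  levelSize-clear-≢ : ∀ Z i c j k → j ≢ i → levelSize (clear Z i c) (j , k) ≡ levelSize Z (j , k)
  levelSize-clear-≢ Z i c j k j≢i =
    ∑-cong (allFin q) (λ {c′} _ → cong (λ v → 𝟙 (v ≟ k)) (clear-other Z i c j c′ (λ e → j≢i (cong proj₁ e))))

  levelSize-clear-≡ : ∀ Z i c k → 0 < k → levelSize (clear Z i c) (i , k) ≡ levelSize Z (i , k) ∸ 𝟙 (Z i c ≟ k)
  levelSize-clear-≡ Z i c k 0<k = begin
    ∑ (allFin q) after                           ≡⟨ m+n∸n≡m _ (before c) ⟨
    ∑ (allFin q) after + before c ∸ before c     ≡⟨ cong (_∸ before c) split ⟨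
    ∑ (allFin q) before ∸ before c               ∎
    where
    open ≡-Reasoning
    before after : Fin q → ℕ
    before c′ = 𝟙 (Z i c′ ≟ k)
    after  c′ = 𝟙 (clear Z i c i c′ ≟ k)
    after-c≡0 : after c ≡ 0
    after-c≡0 = trans (cong (λ v → 𝟙 (v ≟ k)) (clear-same Z i c)) (𝟙-no (0 ≟ k) (<⇒≢ 0<k))
    before≡after : ∀ {c′} → c′ ∈ allFin q → c′ ≢ c → before c′ ≡ after c′
    before≡after {c′} _ c′≢c = cong (λ v → 𝟙 (v ≟ k)) (sym (clear-other Z i c i c′ (λ e → c′≢c (cong proj₂ e))))
    split : ∑ (allFin q) before ≡ ∑ (allFin q) after + before c
    split = begin
      ∑ (allFin q) before            ≡⟨ +-identityʳ _ ⟨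
      ∑ (allFin q) before + 0        ≡⟨ cong (∑ (allFin q) before +_) after-c≡0 ⟨
      ∑ (allFin q) before + after c  ≡⟨ ∑-differ-at (allFin⁺ q) (∈-allFin c) before≡after ⟩
      ∑ (allFin q) after + before c  ∎

  levelSize-clear : ∀ Z i c κ → 0 < proj₂ κ → levelSize (clear Z i c) κ ≡ levelSize Z κ ∸ 𝟙 (κ ≟L (i , Z i c))
  levelSize-clear Z i c (j , k) 0<k = by-cases (j ≟I i)
    where
    by-cases : Dec (j ≡ i) → levelSize (clear Z i c) (j , k) ≡ levelSize Z (j , k) ∸ 𝟙 ((j , k) ≟L (i , Z i c))
    by-cases (no j≢i) = trans (levelSize-clear-≢ Z i c j k j≢i) (cong (levelSize Z (j , k) ∸_)
      (sym (𝟙-no ((j , k) ≟L (i , Z i c)) (λ e → j≢i (cong proj₁ e)))))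
    by-cases (yes refl) = trans (levelSize-clear-≡ Z i c k 0<k) (cong (levelSize Z (j , k) ∸_)
      (𝟙-cong (Z i c ≟ k) ((j , k) ≟L (i , Z i c)) (λ e → cong (i ,_) (sym e)) (λ e → sym (cong proj₂ e))))

  choices≡∏ : ∀ keys → Unique keys → All (λ κ → 0 < proj₂ κ) keys →
              ∀ ls → All (_∈ keys) ls → ∀ Z →
              choices ls Z ≡ ∏[ κ ∈ keys ] fallingFactorial (levelSize Z κ) (count (_≟L κ) ls)
  choices≡∏ keys keys! keys-pos []             _            Z = sym (∏-1 keys)
  choices≡∏ keys keys! keys-pos ((i , k) ∷ ls) (ik∈ ∷ ls⊆) Z = begin
    choices ((i , k) ∷ ls) Z                                       ≡⟨ choices-∷ i k ls Z ⟩
    ∑[ c ∈ allFin q ] (𝟙 (Z i c ≟ k) * choices ls (clear Z i c))   ≡⟨ ∑-𝟙*-constant (λ c → Z i c ≟ k) (allFin q) _ rest choices-rest ⟩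
    levelSize Z (i , k) * rest                                      ≡⟨ ∏-differ-at (levelSize Z (i , k)) keys! ik∈ off-ik at-ik ⟨
    ∏[ κ ∈ keys ] fallingFactorial (levelSize Z κ) (count (_≟L κ) ((i , k) ∷ ls)) ∎
    where
    open ≡-Reasoning
    rest-factor : Label → ℕ
    rest-factor κ = fallingFactorial (levelSize Z κ ∸ 𝟙 (κ ≟L (i , k))) (count (_≟L κ) ls)
    rest : ℕ
    rest = ∏ keys rest-factor
    choices-rest : ∀ {c} → Z i c ≡ k → choices ls (clear Z i c) ≡ rest
    choices-rest {c} Zic≡k = trans (choices≡∏ keys keys! keys-pos ls ls⊆ (clear Z i c)) (∏-cong keys λ κ∈ →
      cong (λ e → fallingFactorial e (count (_≟L _) ls))
        (trans (levelSize-clear Z i c _ (All.lookup keys-pos κ∈)) (cong (λ k′ → levelSize Z _ ∸ 𝟙 (_ ≟L (i , k′))) Zic≡k)))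
    off-ik : ∀ {κ} → κ ∈ keys → κ ≢ (i , k) →
             fallingFactorial (levelSize Z κ) (count (_≟L κ) ((i , k) ∷ ls)) ≡ rest-factor κ
    off-ik {κ} _ κ≢ik = cong₂ fallingFactorial (cong (levelSize Z κ ∸_) (sym (𝟙-no (κ ≟L (i , k)) κ≢ik)))
                                                (cong (_+ count (_≟L κ) ls) (𝟙-no ((i , k) ≟L κ) (λ e → κ≢ik (sym e))))
    at-ik : fallingFactorial (levelSize Z (i , k)) (count (_≟L (i , k)) ((i , k) ∷ ls)) ≡ levelSize Z (i , k) * rest-factor (i , k)
    at-ik rewrite 𝟙-yes ((i , k) ≟L (i , k)) refl = fallingFactorial-suc (levelSize Z (i , k)) (count (_≟L (i , k)) ls)

  module Tagging {V : Set} (site : V → I) (weight : V → ℕ) (weight-pos : ∀ v → 0 < weight v) where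

    tags : List V → List Label
    tags = map (λ v → site v , weight v)

    Fits : Table → (V → Fin q) → List V → Set
    Fits Z x = All (λ v → Z (site v) (x v) ≡ weight v)

    Separated : (V → Fin q) → List V → Set
    Separated x = AllPairs (λ u v → site u ≡ site v → x u ≢ x v)

    private
      Avoids : (V → Fin q) → I → Fin q → List V → Set
      Avoids x i c = All (λ v → site v ≡ i → x v ≢ c)

      Fits-clear⁻ : ∀ Z i c x vs → Fits (clear Z i c) x vs → Fits Z x vs × Avoids x i c vs
      Fits-clear⁻ Z i c x []       []         = [] , []
      Fits-clear⁻ Z i c x (v ∷ vs) (fit ∷ fits) with (site v , x v) ≟IC (i , c) | Fits-clear⁻ Z i c x vs fits
      ... | yes _ | _                = ⊥-elim (<⇒≢ (weight-pos v) fit)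
      ... | no ≢ic | fits′ , avoids = fit ∷ fits′ , (λ e₁ e₂ → ≢ic (cong₂ _,_ e₁ e₂)) ∷ avoids

      Fits-clear⁺ : ∀ Z i c x vs → Fits Z x vs → Avoids x i c vs → Fits (clear Z i c) x vs
      Fits-clear⁺ Z i c x []       []           []             = []
      Fits-clear⁺ Z i c x (v ∷ vs) (fit ∷ fits) (avoid ∷ avoids) =
        trans (clear-other Z i c (site v) (x v) (λ e → avoid (cong proj₁ e) (cong proj₂ e))) fit
        ∷ Fits-clear⁺ Z i c x vs fits avoids

      flip : ∀ {a b : I} {c d : Fin q} → (a ≡ b → c ≢ d) → b ≡ a → d ≢ c
      flip a≡b→c≢d b≡a d≡c = a≡b→c≢d (sym b≡a) (sym d≡c)

    Choice⇒Fits×Separated : ∀ Z vs x → Choice Z (tags vs) (map x vs) → Fits Z x vs × Separated x vs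
    Choice⇒Fits×Separated Z []       x _             = [] , []
    Choice⇒Fits×Separated Z (v ∷ vs) x (fit , choice)
      with fits , separated ← Choice⇒Fits×Separated (clear Z (site v) (x v)) vs x choice
      with fits′ , avoids ← Fits-clear⁻ Z (site v) (x v) x vs fits
      = fit ∷ fits′ , All.map flip avoids ∷ separated

    Fits×Separated⇒Choice : ∀ Z vs x → Fits Z x vs → Separated x vs → Choice Z (tags vs) (map x vs)
    Fits×Separated⇒Choice Z []       x _            _                  = tt
    Fits×Separated⇒Choice Z (v ∷ vs) x (fit ∷ fits) (sep ∷ separated) =
      fit , Fits×Separated⇒Choice (clear Z (site v) (x v)) vs x (Fits-clear⁺ Z (site v) (x v) x vs fits (All.map flip sep)) separated

module JoinGraphColourings {I : Set} (_≟I_ : DecidableEquality I) (G : MarkedGraph I) (m : I → ℕ)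
  (supp : List I) (supp! : Unique supp) (supp-complete : ∀ i → m i ≢ 0 → i ∈ supp) (q : ℕ) where

  open SequentialChoice _≟I_ q

  MarkedMap : Set
  MarkedMap = Setoid.Carrier (MarkedMaps G m q)

  -- Γ has type Λ when every Γ(i) takes each value k on exactly d_k^{Λ_i} colours; it suffices to
  -- check k = suc j ≤ m i, since parts of Λ i and values of Γ i are at most m i.
  HasType : MarkedMap → SCarrier G m → Set
  HasType (Γ , _) (Λ , _) = All (λ i → All (λ j → levelSize Γ (i , suc j) ≡ multiplicity (suc j) (Λ i)) (upTo (m i))) supp

  hasType? : ∀ Γ Λ → Dec (HasType Γ Λ)
  hasType? (Γ , _) (Λ , _) =
    All.all? (λ i → All.all? (λ j → levelSize Γ (i , suc j) ≟ multiplicity (suc j) (Λ i)) (upTo (m i))) supp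

  ∑-weighted-levelSize : (Γ : MarkedMap) → ∀ i → ∑[ j ∈ upTo (m i) ] (suc j * levelSize (proj₁ Γ) (i , suc j)) ≡ m i
  ∑-weighted-levelSize (Γ , _ , Γ-sum , _) i = begin
    ∑[ j ∈ upTo (m i) ] (suc j * levelSize Γ (i , suc j))
      ≡⟨ ∑-cong (upTo (m i)) (λ {j} _ → cong (suc j *_) (∑-map _ (Γ i) (allFin q))) ⟨
    ∑[ j ∈ upTo (m i) ] (suc j * multiplicity (suc j) (map (Γ i) (allFin q)))
      ≡⟨ ∑-weighted-multiplicity (m i) (map (Γ i) (allFin q)) values≤m ⟩
    sum (map (Γ i) (allFin q))
      ≡⟨ Γ-sum′ ⟩
    m i ∎
    where
    open ≡-Reasoning
    Γ-sum′ : ∑ (allFin q) (Γ i) ≡ m i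
    Γ-sum′ = trans (sym (sumFin≡∑ (Γ i))) (Γ-sum i)
    values≤m : All (_≤ m i) (map (Γ i) (allFin q))
    values≤m = Allₚ.map⁺ (All.tabulate (λ c∈ → ≤-trans (term≤∑ (Γ i) c∈) (≤-reflexive Γ-sum′)))

  module Fibres (Λ : SCarrier G m) where

    Λᵢ : I → List ℕ
    Λᵢ = proj₁ Λ

    Λᵢ-partition : ∀ i → IsPartition (m i) (Λᵢ i)
    Λᵢ-partition = proj₁ (proj₂ Λ)

    Vertex : Set
    Vertex = JoinVertex (sVec Λᵢ)

    _≟V_ : DecidableEquality Vertex
    _≟V_ = ≡-dec _≟I_ Finₚ._≟_

    weight : Vertex → ℕ
    weight (i , r) = lookup (Λᵢ i) r

    weight-positive : ∀ u → 0 < weight u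
    weight-positive (i , r) = All.lookup (proj₁ (proj₂ (Λᵢ-partition i))) (∈-lookup r)

    block : I → List Vertex
    block i = tabulate (i ,_)

    vertices : List Vertex
    vertices = concatMap block supp

    vertices-unique : Unique vertices
    vertices-unique = Unique-concatMap block supp! (λ i → tabulate⁺ λ { refl → refl })
      (λ u∈i u∈j → trans (sym (site-block u∈i)) (site-block u∈j))
      where
      site-block : ∀ {i u} → u ∈ block i → proj₁ u ≡ i
      site-block u∈ with _ , refl ← ∈-tabulate⁻ u∈ = refl

    vertices-complete : ∀ u → u ∈ vertices
    vertices-complete (i , r) with m i ≟ 0
    ... | yes m≡0 = ⊥-elim (Finₚ.¬Fin0 (subst (λ λs → Fin (length λs)) (partition-of-0 (Λᵢ-partition i) m≡0) r))
    ... | no  m≢0 = ∈-concatMap⁺ block (lose (supp-complete i m≢0) (∈-tabulate⁺ r))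

    open Tagging proj₁ weight weight-positive

    label : Vertex → Label
    label u = proj₁ u , weight u

    labels : List Label
    labels = tags vertices

    Colouring : Set
    Colouring = Setoid.Carrier (ProperColourings G (sVec Λᵢ) q)

    toTable : (Vertex → Fin q) → Table
    toTable x i c = ∑[ r ∈ allFin (length (Λᵢ i)) ] (𝟙 (x (i , r) Finₚ.≟ c) * weight (i , r))

    module _ (X : Colouring) where

      private
        x : Vertex → Fin q
        x = proj₁ X

      block-injective : ∀ {i r r′} → x (i , r) ≡ x (i , r′) → r ≡ r′
      block-injective {i} {r} {r′} eq with r Finₚ.≟ r′
      ... | yes r≡r′ = r≡r′
      ... | no  r≢r′ = ⊥-elim (proj₂ X (i , r) (i , r′) (inj₁ (refl , λ { refl → r≢r′ refl })) eq)

      toTable-hit : ∀ i r → toTable x i (x (i , r)) ≡ weight (i , r)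
      toTable-hit i r = begin
        toTable x i (x (i , r))                          ≡⟨ ∑-single _ (allFin⁺ _) (∈-allFin r) other-copies ⟩
        𝟙 (x (i , r) Finₚ.≟ x (i , r)) * weight (i , r) ≡⟨ cong (_* weight (i , r)) (𝟙-yes (x (i , r) Finₚ.≟ x (i , r)) refl) ⟩
        1 * weight (i , r)                               ≡⟨ +-identityʳ _ ⟩
        weight (i , r)                                   ∎
        where
        open ≡-Reasoning
        other-copies : ∀ {r′} → r′ ∈ allFin _ → r′ ≢ r → 𝟙 (x (i , r′) Finₚ.≟ x (i , r)) * weight (i , r′) ≡ 0
        other-copies {r′} _ r′≢r = cong (_* weight (i , r′)) (𝟙-no (x (i , r′) Finₚ.≟ x (i , r)) (λ e → r′≢r (block-injective e)))

      toTable-miss : ∀ i c → (∀ r → x (i , r) ≢ c) → toTable x i c ≡ 0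
      toTable-miss i c miss = ∑-zero _ (allFin _) (λ {r} _ → cong (_* weight (i , r)) (𝟙-no (x (i , r) Finₚ.≟ c) (miss r)))

      toTable-cases : ∀ i c → (∃ λ r → x (i , r) ≡ c) ⊎ toTable x i c ≡ 0
      toTable-cases i c with Finₚ.any? (λ r → x (i , r) Finₚ.≟ c)
      ... | yes hit = inj₁ hit
      ... | no  miss = inj₂ (toTable-miss i c (λ r e → miss (r , e)))

      sumFin-toTable : ∀ i → sumFin (toTable x i) ≡ m i
      sumFin-toTable i = begin
        sumFin (toTable x i)
          ≡⟨ sumFin≡∑ (toTable x i) ⟩
        ∑[ c ∈ allFin q ] ∑[ r ∈ rs ] (𝟙 (x (i , r) Finₚ.≟ c) * weight (i , r))
          ≡⟨ ∑-comm (allFin q) rs _ ⟩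
        ∑[ r ∈ rs ] ∑[ c ∈ allFin q ] (𝟙 (x (i , r) Finₚ.≟ c) * weight (i , r))
          ≡⟨ ∑-cong rs (λ {r} _ → ∑-𝟙*-constant (x (i , r) Finₚ.≟_) (allFin q) _ (weight (i , r)) (λ _ → refl)) ⟩
        ∑[ r ∈ rs ] (count (x (i , r) Finₚ.≟_) (allFin q) * weight (i , r))
          ≡⟨ ∑-cong rs (λ {r} _ → cong (_* weight (i , r)) (colour-once (x (i , r)))) ⟩
        ∑[ r ∈ rs ] (1 * weight (i , r))
          ≡⟨ ∑-cong rs (λ _ → +-identityʳ _) ⟩
        sum (map (lookup (Λᵢ i)) rs)
          ≡⟨ cong sum (trans (map-tabulate (λ r → r) (lookup (Λᵢ i))) (tabulate-lookup (Λᵢ i))) ⟩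
        sum (Λᵢ i)
          ≡⟨ proj₂ (proj₂ (Λᵢ-partition i)) ⟩
        m i ∎
        where
        open ≡-Reasoning
        rs : List (Fin (length (Λᵢ i)))
        rs = allFin (length (Λᵢ i))
        colour-once : ∀ c → count (c Finₚ.≟_) (allFin q) ≡ 1
        colour-once c = count≡1 (setoid (Fin q)) (c Finₚ.≟_) (allFin⁺ q) (λ c≡c′ c≡c″ → trans (sym c≡c′) c≡c″) (lose (∈-allFin c) refl)

      toTable-≤1 : ∀ i → isoIt G i ≡ false → ∀ c → toTable x i c ≤ 1
      toTable-≤1 i not-iso c with toTable-cases i c
      ... | inj₂ ≡0         = subst (_≤ 1) (sym ≡0) z≤n
      ... | inj₁ (r , refl) = ≤-reflexive (trans (toTable-hit i r) (All.lookup parts≡1 (∈-lookup r)))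
        where
        parts≡1 : All (_≡ 1) (Λᵢ i)
        parts≡1 = subst (All (_≡ 1)) (sym (proj₂ (proj₂ Λ) i not-iso)) (replicate⁺ (m i) refl)

      toTable-disjoint : ∀ i j → adj G i j ≡ true → ∀ c → toTable x i c ≡ 0 ⊎ toTable x j c ≡ 0
      toTable-disjoint i j i~j c with toTable-cases i c | toTable-cases j c
      ... | inj₂ ≡0           | _                 = inj₁ ≡0
      ... | inj₁ _            | inj₂ ≡0           = inj₂ ≡0
      ... | inj₁ (r , xir≡c) | inj₁ (s , xjs≡c) = ⊥-elim (proj₂ X (i , r) (j , s) (inj₂ i~j) (trans xir≡c (sym xjs≡c)))

      markedMapOf : MarkedMap
      markedMapOf = toTable x , toTable-≤1 , sumFin-toTable , toTable-disjoint

      Choice-markedMapOf : Choice (toTable x) labels (map x vertices)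
      Choice-markedMapOf = Fits×Separated⇒Choice (toTable x) vertices x
        (All.tabulate (λ {u} _ → toTable-hit (proj₁ u) (proj₂ u)))
        (AllPairs.map (λ {u} {v} u≢v same-site → proj₂ X u v (inj₁ (same-site , u≢v))) vertices-unique)

      Choice⇒≈markedMapOf : (Γ : MarkedMap) → Choice (proj₁ Γ) labels (map x vertices) → ∀ i c → proj₁ Γ i c ≡ toTable x i c
      Choice⇒≈markedMapOf (Γ , _ , Γ-sum , _) choice i c =
        sym (∑-≤-≡⇒≡ (All.tabulate (λ {c} _ → toTable≤Γ c)) sums (∈-allFin c))
        where
        fits : Fits Γ x vertices
        fits = proj₁ (Choice⇒Fits×Separated Γ vertices x choice)
        toTable≤Γ : ∀ c → toTable x i c ≤ Γ i c
        toTable≤Γ c with toTable-cases i c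
        ... | inj₂ ≡0         = subst (_≤ Γ i c) (sym ≡0) z≤n
        ... | inj₁ (r , refl) = ≤-reflexive (trans (toTable-hit i r) (sym (All.lookup fits (vertices-complete (i , r)))))
        sums : ∑ (allFin q) (toTable x i) ≡ ∑ (allFin q) (Γ i)
        sums = begin
          ∑ (allFin q) (toTable x i) ≡⟨ sumFin≡∑ (toTable x i) ⟨
          sumFin (toTable x i)       ≡⟨ sumFin-toTable i ⟩
          m i                        ≡⟨ Γ-sum i ⟨
          sumFin (Γ i)               ≡⟨ sumFin≡∑ (Γ i) ⟩
          ∑ (allFin q) (Γ i)         ∎
          where open ≡-Reasoning

    colouringOf : (Γ : MarkedMap) (cs : List (Fin q)) → Choice (proj₁ Γ) labels cs →
                  Σ Colouring λ X → map (proj₁ X) vertices ≡ cs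
    colouringOf (Γ , _ , _ , Γ-disjoint) cs choice = (x , proper) , x-lists-cs
      where
      length-cs : length cs ≡ length vertices
      length-cs = trans (Choice-length Γ labels cs choice) (length-map _ vertices)
      x : Vertex → Fin q
      x u = zipLookup _≟V_ vertices cs length-cs (vertices-complete u)
      x-lists-cs : map x vertices ≡ cs
      x-lists-cs = map-zipLookup _≟V_ vertices-unique cs length-cs x
        (λ u∈ → cong (zipLookup _≟V_ vertices cs length-cs) (unique⇒irrelevant vertices-unique _ u∈))
      fits×separated : Fits Γ x vertices × Separated x vertices
      fits×separated = Choice⇒Fits×Separated Γ vertices x (subst (Choice Γ labels) (sym x-lists-cs) choice)
      fit : ∀ u → Γ (proj₁ u) (x u) ≡ weight u
      fit u = All.lookup (proj₁ fits×separated) (vertices-complete u)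
      proper : ∀ u v → JoinAdj G (sVec Λᵢ) u v → x u ≢ x v
      proper u v (inj₁ (same-site , u≢v)) =
        AllPairs-lookup (λ sep e₁ e₂ → sep (sym e₁) (sym e₂)) (proj₂ fits×separated)
                        (vertices-complete u) (vertices-complete v) u≢v same-site
      proper u v (inj₂ u~v) xu≡xv with Γ-disjoint (proj₁ u) (proj₁ v) u~v (x u)
      ... | inj₁ Γu≡0 = <⇒≢ (weight-positive u) (trans (sym Γu≡0) (fit u))
      ... | inj₂ Γv≡0 = <⇒≢ (weight-positive v) (trans (sym Γv≡0) (trans (cong (Γ (proj₁ v)) xu≡xv) (fit v)))

    colourings≡∑choices : ∀ {xs Γs} → IsListing (ProperColourings G (sVec Λᵢ) q) xs → IsListing (MarkedMaps G m q) Γs →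
                          length xs ≡ ∑[ Γ ∈ Γs ] choices labels (proj₁ Γ)
    colourings≡∑choices {xs} {Γs} xs-listing (Γs! , Γs-complete) = begin
      length xs                                                      ≡⟨ length≡∑-fibres InFibre? xs Γs one-fibre ⟩
      ∑[ Γ ∈ Γs ] count (λ X → InFibre? X Γ) xs                      ≡⟨ ∑-cong Γs (λ {Γ} _ → fibre-size Γ) ⟩
      ∑[ Γ ∈ Γs ] choices labels (proj₁ Γ)                           ∎
      where
      open ≡-Reasoning
      InFibre? : ∀ X Γ → Dec (Choice (proj₁ Γ) labels (map (proj₁ X) vertices))
      InFibre? X Γ = choice? (proj₁ Γ) labels (map (proj₁ X) vertices)
      one-fibre : ∀ {X} → X ∈ xs → count (InFibre? X) Γs ≡ 1
      one-fibre {X} _ = count≡1 (MarkedMaps G m q) (InFibre? X) Γs!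
        (λ {Γ} {Γ′} in-Γ in-Γ′ i c → trans (Choice⇒≈markedMapOf X Γ in-Γ i c) (sym (Choice⇒≈markedMapOf X Γ′ in-Γ′ i c)))
        (Any.map (λ {Γ} X≈Γ → Choice-cong X≈Γ labels _ (Choice-markedMapOf X)) (Γs-complete (markedMapOf X)))
      fibre-size : ∀ Γ → count (λ X → InFibre? X Γ) xs ≡ choices labels (proj₁ Γ)
      fibre-size Γ = count-transport (ProperColourings G (sVec Λᵢ) q) (choice? (proj₁ Γ) labels) (λ X → map (proj₁ X) vertices)
        (λ eq u → All.lookup (map-cong-local⁻ eq) (vertices-complete u)) (λ X≈Y → map-cong X≈Y vertices)
        xs-listing (colourLists-unique (length labels))
        (λ {cs} choice → subst (λ n → cs ∈ colourLists n) (Choice-length (proj₁ Γ) labels cs choice) (colourLists-complete cs))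
        (λ {cs} choice → colouringOf Γ cs choice)

    keys : List Label
    keys = concatMap (λ i → map (λ j → i , suc j) (upTo (m i))) supp

    keys-unique : Unique keys
    keys-unique = Unique-concatMap _ supp! (λ i → map⁺-unique (λ { refl → refl }) (upTo⁺ (m i)))
      (λ κ∈i κ∈i′ → trans (sym (site-key κ∈i)) (site-key κ∈i′))
      where
      site-key : ∀ {i κ} → κ ∈ map (λ j → i , suc j) (upTo (m i)) → proj₁ κ ≡ i
      site-key κ∈ with _ , _ , refl ← ∈-map⁻ _ κ∈ = refl

    keys-positive : All (λ κ → 0 < proj₂ κ) keys
    keys-positive = All.tabulate λ κ∈ → positive (find (∈-concatMap⁻ _ {xs = supp} κ∈))
      where
      positive : ∀ {κ} → ∃ (λ i → i ∈ supp × κ ∈ map (λ j → i , suc j) (upTo (m i))) → 0 < proj₂ κ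
      positive (i , _ , κ∈) with _ , _ , refl ← ∈-map⁻ _ κ∈ = s≤s z≤n

    labels⊆keys : All (_∈ keys) labels
    labels⊆keys = Allₚ.map⁺ (All.tabulate (λ {u} _ → label∈keys u))
      where
      label∈keys : ∀ u → label u ∈ keys
      label∈keys u@(i , r) with weight u | weight-positive u | All.lookup (partition-parts≤ (Λᵢ-partition i)) (∈-lookup r)
      ... | suc j | _ | j<m = ∈-concatMap⁺ _ (lose (supp-complete i (m<n⇒n≢0 j<m)) (∈-map⁺ (λ j → i , suc j) (∈-upTo⁺ j<m)))

    block-labels : ∀ i → map label (block i) ≡ map (i ,_) (Λᵢ i)
    block-labels i = begin
      map label (tabulate (i ,_))                       ≡⟨ map-tabulate (i ,_) label ⟩
      tabulate (λ r → i , lookup (Λᵢ i) r)              ≡⟨ map-tabulate (lookup (Λᵢ i)) (i ,_) ⟨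
      map (i ,_) (tabulate (lookup (Λᵢ i)))             ≡⟨ cong (map (i ,_)) (tabulate-lookup (Λᵢ i)) ⟩
      map (i ,_) (Λᵢ i)                                 ∎
      where open ≡-Reasoning

    ∑-block : ∀ i (f : Label → ℕ) → ∑[ u ∈ block i ] f (label u) ≡ ∑[ v ∈ Λᵢ i ] f (i , v)
    ∑-block i f = trans (sym (∑-map f label (block i))) (trans (cong (λ ls → ∑ ls f) (block-labels i)) (∑-map f (i ,_) (Λᵢ i)))

    count-labels : ∀ {i} k → i ∈ supp → count (_≟L (i , k)) labels ≡ multiplicity k (Λᵢ i)
    count-labels {i} k i∈ = begin
      count (_≟L (i , k)) labels                            ≡⟨ ∑-map _ label vertices ⟩
      ∑[ u ∈ vertices ] 𝟙 (label u ≟L (i , k))              ≡⟨ ∑-concatMap _ block supp ⟩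
      ∑[ i′ ∈ supp ] ∑[ u ∈ block i′ ] 𝟙 (label u ≟L (i , k)) ≡⟨ ∑-single _ supp! i∈ other-sites ⟩
      ∑[ u ∈ block i ] 𝟙 (label u ≟L (i , k))               ≡⟨ ∑-block i (λ κ → 𝟙 (κ ≟L (i , k))) ⟩
      ∑[ v ∈ Λᵢ i ] 𝟙 ((i , v) ≟L (i , k))
        ≡⟨ ∑-cong (Λᵢ i) (λ {v} _ → 𝟙-cong ((i , v) ≟L (i , k)) (v ≟ k) (cong proj₂) (cong (i ,_))) ⟩
      multiplicity k (Λᵢ i)                                 ∎
      where
      open ≡-Reasoning
      other-sites : ∀ {i′} → i′ ∈ supp → i′ ≢ i → ∑[ u ∈ block i′ ] 𝟙 (label u ≟L (i , k)) ≡ 0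
      other-sites {i′} _ i′≢i =
        trans (∑-block i′ (λ κ → 𝟙 (κ ≟L (i , k))))
              (∑-zero _ (Λᵢ i′) (λ {v} _ → 𝟙-no ((i′ , v) ≟L (i , k)) (λ e → i′≢i (cong proj₁ e))))

    ∑-weighted-multiplicity-Λᵢ : ∀ i → ∑[ j ∈ upTo (m i) ] (suc j * multiplicity (suc j) (Λᵢ i)) ≡ m i
    ∑-weighted-multiplicity-Λᵢ i = trans (∑-weighted-multiplicity (m i) (Λᵢ i) (partition-parts≤ (Λᵢ-partition i)))
                                         (proj₂ (proj₂ (Λᵢ-partition i)))

    denom≡∏ : denom supp Λᵢ ≡ ∏[ i ∈ supp ] ∏[ j ∈ upTo (m i) ] (multiplicity (suc j) (Λᵢ i) !)
    denom≡∏ = ∏-cong supp λ {i} _ → trans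
      (cong (λ s → ∏[ j ∈ upTo s ] (mult (suc j) (Λᵢ i) !)) (proj₂ (proj₂ (Λᵢ-partition i))))
      (∏-cong (upTo (m i)) (λ {j} _ → cong _! (sym (count≡length∘filter (_≟ suc j) (Λᵢ i)))))

    choices≡𝟙*denom : (Γ : MarkedMap) → choices labels (proj₁ Γ) ≡ 𝟙 (hasType? Γ Λ) * denom supp Λᵢ
    choices≡𝟙*denom Γ = begin
      choices labels (proj₁ Γ)
        ≡⟨ choices≡∏ keys keys-unique keys-positive labels labels⊆keys (proj₁ Γ) ⟩
      ∏[ κ ∈ keys ] fallingFactorial (levelSize (proj₁ Γ) κ) (count (_≟L κ) labels)
        ≡⟨ ∏-concatMap _ _ supp ⟩
      ∏[ i ∈ supp ] ∏[ κ ∈ map (λ j → i , suc j) (upTo (m i)) ] fallingFactorial (levelSize (proj₁ Γ) κ) (count (_≟L κ) labels)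
        ≡⟨ ∏-cong supp (λ {i} i∈ → trans (∏-map _ _ (upTo (m i)))
             (∏-cong (upTo (m i)) (λ {j} _ → cong (fallingFactorial _) (count-labels (suc j) i∈)))) ⟩
      ∏[ i ∈ supp ] ∏[ j ∈ upTo (m i) ] fallingFactorial (levelSize (proj₁ Γ) (i , suc j)) (multiplicity (suc j) (Λᵢ i))
        ≡⟨ ∏-cong supp (λ {i} _ → ∏-fallingFactorial (upTo (m i)) _ _
             (trans (∑-weighted-levelSize Γ i) (sym (∑-weighted-multiplicity-Λᵢ i)))) ⟩
      ∏[ i ∈ supp ] (𝟙 (All.all? (λ j → levelSize (proj₁ Γ) (i , suc j) ≟ multiplicity (suc j) (Λᵢ i)) (upTo (m i)))
                     * ∏[ j ∈ upTo (m i) ] (multiplicity (suc j) (Λᵢ i) !))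
        ≡⟨ ∏-𝟙* _ _ supp ⟩
      𝟙 (hasType? Γ Λ) * ∏[ i ∈ supp ] ∏[ j ∈ upTo (m i) ] (multiplicity (suc j) (Λᵢ i) !)
        ≡⟨ cong (𝟙 (hasType? Γ Λ) *_) denom≡∏ ⟨
      𝟙 (hasType? Γ Λ) * denom supp Λᵢ ∎
      where open ≡-Reasoning

    length≡count-hasType*denom : ∀ {xs Γs} → IsListing (ProperColourings G (sVec Λᵢ) q) xs → IsListing (MarkedMaps G m q) Γs →
                             length xs ≡ count (λ Γ → hasType? Γ Λ) Γs * denom supp Λᵢ
    length≡count-hasType*denom {xs} {Γs} xs-listing Γs-listing = begin
      length xs                                            ≡⟨ colourings≡∑choices xs-listing Γs-listing ⟩
      ∑[ Γ ∈ Γs ] choices labels (proj₁ Γ)                 ≡⟨ ∑-cong Γs (λ {Γ} _ → choices≡𝟙*denom Γ) ⟩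
      ∑[ Γ ∈ Γs ] (𝟙 (hasType? Γ Λ) * denom supp Λᵢ)       ≡⟨ ∑-𝟙*-constant (λ Γ → hasType? Γ Λ) Γs _ _ (λ _ → refl) ⟩
      count (λ Γ → hasType? Γ Λ) Γs * denom supp Λᵢ        ∎
      where open ≡-Reasoning

  typeOf : MarkedMap → SCarrier G m
  typeOf (Γ , Γ-≤1 , Γ-sum , _) = (λ i → partitionOf (values i)) , (λ i → partition i) , not-iso
    where
    values : I → List ℕ
    values i = map (Γ i) (allFin q)
    sum-parts : ∀ i → sum (partitionOf (values i)) ≡ m i
    sum-parts i = trans (sum-partitionOf (values i)) (trans (sym (sumFin≡∑ (Γ i))) (Γ-sum i))
    partition : ∀ i → IsPartition (m i) (partitionOf (values i))
    partition i = partitionOf-descending (values i) , partitionOf-positive (values i) , sum-parts i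
    not-iso : ∀ i → isoIt G i ≡ false → partitionOf (values i) ≡ replicate (m i) 1
    not-iso i i-not-iso = trans (all≡1⇒replicate _ parts≡1) (cong (λ s → replicate s 1) (sum-parts i))
      where
      parts≡1 : All (_≡ 1) (partitionOf (values i))
      parts≡1 = All.zipWith (λ (0<v , v≤1) → ≤-antisym v≤1 0<v)
        (partitionOf-positive (values i) , partitionOf-All (values i) (Allₚ.map⁺ (All.tabulate (λ {c} _ → Γ-≤1 i i-not-iso c))))

  HasType-typeOf : ∀ Γ → HasType Γ (typeOf Γ)
  HasType-typeOf (Γ , _) = All.tabulate λ {i} _ → All.tabulate λ {j} _ → sym (begin
    multiplicity (suc j) (partitionOf (map (Γ i) (allFin q))) ≡⟨ multiplicity-partitionOf (map (Γ i) (allFin q)) (suc j) (s≤s z≤n) ⟩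
    multiplicity (suc j) (map (Γ i) (allFin q))               ≡⟨ ∑-map _ (Γ i) (allFin q) ⟩
    levelSize Γ (i , suc j)                                    ∎)
    where open ≡-Reasoning

  HasType-resp : ∀ {Γ Λ Λ′} → (∀ i → proj₁ Λ i ≡ proj₁ Λ′ i) → HasType Γ Λ → HasType Γ Λ′
  HasType-resp Λ≈Λ′ = All.map (λ {i} → All.map (λ {j} e → trans e (cong (multiplicity (suc j)) (Λ≈Λ′ i))))

  HasType-unique : ∀ {Γ Λ Λ′} → HasType Γ Λ → HasType Γ Λ′ → ∀ i → proj₁ Λ i ≡ proj₁ Λ′ i
  HasType-unique {Γ} {Λ , Λ-partition , _} {Λ′ , Λ′-partition , _} type type′ i with m i ≟ 0
  ... | yes m≡0 = trans (partition-of-0 (Λ-partition i) m≡0) (sym (partition-of-0 (Λ′-partition i) m≡0))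
  ... | no  m≢0 = sorted-multiplicity-injective (Λ i) (Λ′ i) (proj₁ (Λ-partition i)) (proj₁ (Λ′-partition i)) same-multiplicity
    where
    i∈ : i ∈ supp
    i∈ = supp-complete i m≢0
    multiplicity-large : ∀ {λs k} → IsPartition (m i) λs → m i < k → multiplicity k λs ≡ 0
    multiplicity-large part m<k = multiplicity-> _ _ (All.map (λ v≤m → ≤-<-trans v≤m m<k) (partition-parts≤ part))
    multiplicity-0 : ∀ {λs} → IsPartition (m i) λs → multiplicity 0 λs ≡ 0
    multiplicity-0 part = count-none (_≟ 0) (All.map (λ 0<v v≡0 → <⇒≢ 0<v (sym v≡0)) (proj₁ (proj₂ part)))
    same-multiplicity : ∀ k → multiplicity k (Λ i) ≡ multiplicity k (Λ′ i)
    same-multiplicity zero = trans (multiplicity-0 (Λ-partition i)) (sym (multiplicity-0 (Λ′-partition i)))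
    same-multiplicity (suc j) with j <? m i
    ... | yes j<m = trans (sym (All.lookup (All.lookup type i∈) (∈-upTo⁺ j<m))) (All.lookup (All.lookup type′ i∈) (∈-upTo⁺ j<m))
    ... | no  j≮m = trans (multiplicity-large (Λ-partition i) (s≤s (≮⇒≥ j≮m)))
                          (sym (multiplicity-large (Λ′-partition i) (s≤s (≮⇒≥ j≮m))))

  denom-positive : ∀ Λ → 0 < denom supp Λ
  denom-positive Λ = ∏-positive supp _ (λ i → ∏-positive (upTo (sum (Λ i))) _ (λ k → 1≤n! (mult (suc k) (Λ i))))

  colourings≡count-hasType*denom : ∀ {Γs} → IsListing (MarkedMaps G m q) Γs →
                            ∀ Λ {n} → HasCard (ProperColourings G (sVec (proj₁ Λ)) q) n →
                            n ≡ count (λ Γ → hasType? Γ Λ) Γs * denom supp (proj₁ Λ)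
  colourings≡count-hasType*denom Γs-listing Λ card with _ , length≡n , xs-listing ← HasCard⇒listing _ card =
    trans (sym length≡n) (Fibres.length≡count-hasType*denom Λ xs-listing Γs-listing)

  count-hasType≡1 : ∀ {Λs} → IsListing (SSetoid G m) Λs → ∀ Γ → count (hasType? Γ) Λs ≡ 1
  count-hasType≡1 (Λs! , Λs-complete) Γ = count≡1 (SSetoid G m) (hasType? Γ) Λs! (λ {Λ} {Λ′} → HasType-unique {Γ} {Λ} {Λ′})
    (Any.map (λ {Λ} typeΓ≈Λ → HasType-resp {Γ} {typeOf Γ} {Λ} typeΓ≈Λ (HasType-typeOf Γ)) (Λs-complete (typeOf Γ)))

proposition3p4 :
  {I : Set} (enc : I → ℕ) → Injective _≡_ _≡_ enc →
  (G : MarkedGraph I) (m : I → ℕ) →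
  (supp : List I) → Unique supp → (∀ i → m i ≢ 0 → i ∈ supp) →
  (q : ℕ) →
  (N : ℕ) → HasCard (MarkedMaps G m q) N →
  (L : List (SCarrier G m)) →
  Enum.IsEnumeration (SSetoid G m) L → USet.Unique (SSetoid G m) L →
  (P : SCarrier G m → ℕ) →
  (∀ Λ → HasCard (ProperColourings G (sVec (proj₁ Λ)) q) (P Λ)) →
  fromℕ N ≡ sumℚ (map (λ Λ → frac (P Λ) (denom supp (proj₁ Λ))) L)
proposition3p4 {I} enc enc-injective G m supp supp! supp-complete q N card-N L L-complete L! P card-P
  with Γs , length≡N , Γs-listing ← HasCard⇒listing (MarkedMaps G m q) card-N = begin
  fromℕ N                                                   ≡⟨ cong fromℕ N≡∑ofType ⟩
  fromℕ (∑[ Λ ∈ L ] ofType Λ)                               ≡⟨ sumℚ-fromℕ L ofType ⟨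
  sumℚ (map (λ Λ → fromℕ (ofType Λ)) L)                    ≡⟨ cong sumℚ (map-cong fraction≡ofType L) ⟨
  sumℚ (map (λ Λ → frac (P Λ) (denom supp (proj₁ Λ))) L)   ∎
  where
  open ≡-Reasoning
  _≟I_ : DecidableEquality I
  i ≟I j = map′ enc-injective (cong enc) (enc i ≟ enc j)
  open JoinGraphColourings _≟I_ G m supp supp! supp-complete q
  ofType : SCarrier G m → ℕ
  ofType Λ = count (λ Γ → hasType? Γ Λ) Γs
  N≡∑ofType : N ≡ ∑[ Λ ∈ L ] ofType Λ
  N≡∑ofType = trans (sym length≡N) (length≡∑-fibres hasType? Γs L (λ {Γ} _ → count-hasType≡1 (L! , L-complete) Γ))
  fraction≡ofType : ∀ Λ → frac (P Λ) (denom supp (proj₁ Λ)) ≡ fromℕ (ofType Λ)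
  fraction≡ofType Λ = trans (cong (λ n → frac n (denom supp (proj₁ Λ))) (colourings≡count-hasType*denom Γs-listing Λ (card-P Λ)))
                            (frac-cancel (ofType Λ) (denom supp (proj₁ Λ)) (denom-positive (proj₁ Λ)))
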